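{- Let $\pi:\tilde G\to G$ be a dilated double cover of a connected graph $G$, and let $A,B,C$ be as defined below. Then there exist a basis $\alpha_1,\dots,\alpha_A,\gamma_1,\dots,\gamma_C$ of $H_1(G,\mathbb Z)$ and a basis $\tilde\alpha_1^\pm,\dots,\tilde\alpha_A^\pm,\tilde\beta_1,\dots,\tilde\beta_B,\tilde\gamma_1,\dots,\tilde\gamma_C$ of $H_1(\tilde G,\mathbb Z)$ such that $\iota_*(\tilde\alpha_i^\pm)=\tilde\alpha_i^\mp$, $\pi_*(\tilde\alpha_i^\pm)=\alpha_i$, $\pi^*(\alpha_i)=\tilde\alpha_i^++\tilde\alpha_i^-$ for $i=1,\dots,A$; $\iota_*(\tilde\beta_j)=-\tilde\beta_j$, $\pi_*(\tilde\beta_j)=0$ for $j=1,\dots,B$; $\iota_*(\tilde\gamma_k)=\tilde\gamma_k$, $\pi_*(\tilde\gamma_k)=\gamma_k$, $\pi^*(\gamma_k)=2\tilde\gamma_k$ for $k=1,\dots,C$.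
   Context: Graphs have vertices, half-edges, a root map and a fixed-point-free involution pairing half-edges into edges; genus of a connected graph is $g(G)=|E|-|V|+1$. A double cover $\pi:\tilde G\to G$ is a harmonic morphism of degree $2$: each vertex or edge $x$ of $G$ is either free (two preimages) or dilated (one preimage, of local degree 2); $\pi$ is dilated if some point is dilated. The dilation subgraph $G_{dil}\subseteq G$ consists of the dilated vertices and edges; let $m_d=|E(G_{dil})|$, $n_d=|V(G_{dil})|$, $d$ the number of connected components of $G_{dil}$, and $A=g(G)-m_d+n_d-d$, $B=d-1$, $C=m_d-n_d+d$. Let $\iota:\tilde G\to\tilde G$ be the involution exchanging preimages of free points (fixing preimages of dilated points). Orient $G$ and $\tilde G$ compatibly. $H_1$ denotes simplicial first homology; $\iota_*$ is induced by $\iota$; $\pi_*$ is induced by $\tilde e\mapsto\pi(\tilde e)$; $\pi^*:H_1(G,\mathbb Z)\to H_1(\tilde G,\mathbb Z)$ is induced by $e\mapsto\tilde e^++\tilde e^-$ for free $e$ with preimages $\tilde e^\pm$ and $e\mapsto2\tilde e$ for dilated $e$ with preimage $\tilde e$. -}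

module Defs where

open import Data.Nat as ℕ using (ℕ; zero; suc; _≤_)
open import Data.Integer as ℤ using (ℤ; +_; _+_; _-_; _*_; -_)
open import Data.Fin using (Fin; zero; suc; splitAt; _≟_)
open import Data.Fin.Properties using (any?)
open import Data.Bool using (Bool; true; false; if_then_else_; _∧_)
open import Data.Product using (Σ; ∃; ∃-syntax; _×_; _,_; proj₁)
open import Data.Sum using (_⊎_; [_,_])
open import Function using (_∘_; _⇔_)
open import Relation.Nullary using (¬_; Dec; does)
open import Relation.Nullary.Decidable using (_×-dec_)
open import Relation.Binary.PropositionalEquality using (_≡_; _≢_)

ΣN : ∀ {n} → (Fin n → ℕ) → ℕ
ΣN {zero}  f = 0
ΣN {suc n} f = f zero ℕ.+ ΣN (f ∘ suc)

ΣZ : ∀ {n} → (Fin n → ℤ) → ℤ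
ΣZ {zero}  f = + 0
ΣZ {suc n} f = f zero + ΣZ (f ∘ suc)

[_≟'_] : ∀ {n} → Fin n → Fin n → Bool
[ x ≟' y ] = does (x ≟ y)

-- Finite (multi)graphs, loops allowed, with a chosen orientation:
-- each edge {h, ι h} is recorded with its tail root(h) = src and head
-- root(ι h) = tgt.

record Graph : Set where
  field
    nV : ℕ
    nE : ℕ
    src : Fin nE → Fin nV
    tgt : Fin nE → Fin nV

open Graph public

Vtx Edg : Graph → Set
Vtx G = Fin (nV G)
Edg G = Fin (nE G)

data Walk (G : Graph) : Vtx G → Vtx G → Set where
  here : ∀ {v} → Walk G v v
  fwd  : ∀ {w} (e : Edg G) → Walk G (tgt G e) w → Walk G (src G e) w
  bwd  : ∀ {w} (e : Edg G) → Walk G (src G e) w → Walk G (tgt G e) w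

Connected : Graph → Set
Connected G = ∀ (u v : Vtx G) → Walk G u v

genus : Graph → ℤ
genus G = + nE G - + nV G + + 1

-- Simplicial chains and first homology H₁(G, ℤ) = ker ∂ ⊆ ℤ^E

Chain : Graph → Set
Chain G = Edg G → ℤ

-- chain equality, zero, sum, negation, scalar multiple (G explicit,
-- since it cannot be inferred from Chain G)
Eqᶜ : (G : Graph) → Chain G → Chain G → Set
Eqᶜ G x y = ∀ e → x e ≡ y e
syntax Eqᶜ G x y = x ≈[ G ] y

0ᶜ : (G : Graph) → Chain G
0ᶜ G e = + 0

addᶜ : (G : Graph) → Chain G → Chain G → Chain G
addᶜ G x y e = x e + y e
syntax addᶜ G x y = x +[ G ] y

negᶜ : (G : Graph) → Chain G → Chain G
negᶜ G x e = - x e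

scaleᶜ : (G : Graph) → ℤ → Chain G → Chain G
scaleᶜ G k x e = k * x e

ind : Bool → ℤ
ind true  = + 1
ind false = + 0

∂ : (G : Graph) → Chain G → Vtx G → ℤ
∂ G z v = ΣZ (λ e → (ind [ tgt G e ≟' v ] - ind [ src G e ≟' v ]) * z e)

IsCycle : (G : Graph) → Chain G → Set
IsCycle G z = ∀ v → ∂ G z v ≡ + 0

lincomb : ∀ {G r} → (Fin r → ℤ) → (Fin r → Chain G) → Chain G
lincomb c b e = ΣZ (λ i → c i * b i e)

IsBasis : (G : Graph) {r : ℕ} → (Fin r → Chain G) → Set
IsBasis G {r} b =
  (∀ i → IsCycle G (b i)) ×
  (∀ z → IsCycle G z → ∃[ c ] (lincomb {G} c b ≈[ G ] z)) ×
  (∀ (c : Fin r → ℤ) → lincomb {G} c b ≈[ G ] 0ᶜ G → ∀ i → c i ≡ + 0)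

_⊕_ : ∀ {p q} {X : Set} → (Fin p → X) → (Fin q → X) → Fin (p ℕ.+ q) → X
_⊕_ {p} f g = [ f , g ] ∘ splitAt p

-- Double covers: harmonic morphisms of degree 2 (no contracted edges),
-- with G̃ and G oriented compatibly (π maps tails to tails, heads to heads).
-- dV, dE are the local degrees.

record DoubleCover (G̃ G : Graph) : Set where
  field
    πV : Vtx G̃ → Vtx G
    πE : Edg G̃ → Edg G
    src-comm : ∀ ẽ → src G (πE ẽ) ≡ πV (src G̃ ẽ)
    tgt-comm : ∀ ẽ → tgt G (πE ẽ) ≡ πV (tgt G̃ ẽ)
    dV : Vtx G̃ → ℕ
    dE : Edg G̃ → ℕ
    dV-pos : ∀ ṽ → 1 ≤ dV ṽ
    dE-pos : ∀ ẽ → 1 ≤ dE ẽ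
    degV : ∀ v → ΣN (λ ṽ → if [ πV ṽ ≟' v ] then dV ṽ else 0) ≡ 2
    degE : ∀ e → ΣN (λ ẽ → if [ πE ẽ ≟' e ] then dE ẽ else 0) ≡ 2
    harm-src : ∀ ṽ e → src G e ≡ πV ṽ →
      ΣN (λ ẽ → if [ πE ẽ ≟' e ] ∧ [ src G̃ ẽ ≟' ṽ ] then dE ẽ else 0) ≡ dV ṽ
    harm-tgt : ∀ ṽ e → tgt G e ≡ πV ṽ →
      ΣN (λ ẽ → if [ πE ẽ ≟' e ] ∧ [ tgt G̃ ẽ ≟' ṽ ] then dE ẽ else 0) ≡ dV ṽ

module _ {G̃ G : Graph} (π : DoubleCover G̃ G) where
  open DoubleCover π

  DilV : Vtx G → Set
  DilV v = ∃[ ṽ ] (πV ṽ ≡ v × dV ṽ ≡ 2)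

  DilE : Edg G → Set
  DilE e = ∃[ ẽ ] (πE ẽ ≡ e × dE ẽ ≡ 2)

  dilV? : ∀ v → Dec (DilV v)
  dilV? v = any? (λ ṽ → (πV ṽ ≟ v) ×-dec (dV ṽ ℕ.≟ 2))

  dilE? : ∀ e → Dec (DilE e)
  dilE? e = any? (λ ẽ → (πE ẽ ≟ e) ×-dec (dE ẽ ℕ.≟ 2))

  IsDilated : Set
  IsDilated = (∃[ v ] DilV v) ⊎ (∃[ e ] DilE e)

  n-dil : ℕ
  n-dil = ΣN (λ v → if does (dilV? v) then 1 else 0)

  m-dil : ℕ
  m-dil = ΣN (λ e → if does (dilE? e) then 1 else 0)

  data DilWalk : Vtx G → Vtx G → Set where
    here : ∀ {v} → DilV v → DilWalk v v
    fwd  : ∀ {w} (e : Edg G) → DilE e → DilWalk (tgt G e) w → DilWalk (src G e) w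
    bwd  : ∀ {w} (e : Edg G) → DilE e → DilWalk (src G e) w → DilWalk (tgt G e) w

  -- G_dil has exactly d connected components: there is a surjective
  -- labelling of the vertices of G_dil by Fin d whose fibres are exactly
  -- the connected components
  NumComponents : ℕ → Set
  NumComponents d =
    Σ (Σ (Vtx G) DilV → Fin d) λ c →
      (∀ k → ∃[ x ] c x ≡ k) ×
      (∀ x y → (c x ≡ c y) ⇔ DilWalk (proj₁ x) (proj₁ y))

  IsSheetInvolution : (Edg G̃ → Edg G̃) → Set
  IsSheetInvolution ι =
    ∀ ẽ → πE (ι ẽ) ≡ πE ẽ ×
          (DilE (πE ẽ) → ι ẽ ≡ ẽ) ×
          (¬ DilE (πE ẽ) → ι ẽ ≢ ẽ)

  ι* : (Edg G̃ → Edg G̃) → Chain G̃ → Chain G̃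
  ι* ι z ẽ = z (ι ẽ)

  π* : Chain G̃ → Chain G
  π* z e = ΣZ (λ ẽ → if [ πE ẽ ≟' e ] then z ẽ else + 0)

  -- pullback: free e ↦ ẽ⁺ + ẽ⁻, dilated e ↦ 2 ẽ
  π^* : Chain G → Chain G̃
  π^* w ẽ = (if does (dilE? (πE ẽ)) then + 2 else + 1) * w (πE ẽ)

  A B C : ℕ → ℤ
  A d = genus G - + m-dil + + n-dil - + d
  B d = + d - + 1
  C d = + m-dil - + n-dil + + d

  record AdaptedBases (ι : Edg G̃ → Edg G̃) (d : ℕ) : Set where
    field
      a b c : ℕ
      a≡A : + a ≡ A d
      b≡B : + b ≡ B d
      c≡C : + c ≡ C d
      α  : Fin a → Chain G
      γ  : Fin c → Chain G
      α̃⁺ α̃⁻ : Fin a → Chain G̃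
      β̃  : Fin b → Chain G̃
      γ̃  : Fin c → Chain G̃
      basis   : IsBasis G (α ⊕ γ)
      basis~  : IsBasis G̃ (α̃⁺ ⊕ (α̃⁻ ⊕ (β̃ ⊕ γ̃)))
      ια⁺ : ∀ i → ι* ι (α̃⁺ i) ≈[ G̃ ] α̃⁻ i
      ια⁻ : ∀ i → ι* ι (α̃⁻ i) ≈[ G̃ ] α̃⁺ i
      πα⁺ : ∀ i → π* (α̃⁺ i) ≈[ G ] α i
      πα⁻ : ∀ i → π* (α̃⁻ i) ≈[ G ] α i
      π^α : ∀ i → π^* (α i) ≈[ G̃ ] (α̃⁺ i +[ G̃ ] α̃⁻ i)
      ιβ  : ∀ j → ι* ι (β̃ j) ≈[ G̃ ] negᶜ G̃ (β̃ j)
      πβ  : ∀ j → π* (β̃ j) ≈[ G ] 0ᶜ G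
      ιγ  : ∀ k → ι* ι (γ̃ k) ≈[ G̃ ] γ̃ k
      πγ  : ∀ k → π* (γ̃ k) ≈[ G ] γ k
      π^γ : ∀ k → π^* (γ k) ≈[ G̃ ] scaleᶜ G̃ (+ 2) (γ̃ k)

{-# OPTIONS --safe #-}
-- Root a spanning tree T of G at a dilated vertex r, growing it greedily with dilated edges first so
-- that its dilated edges span every component of the dilation subgraph; by harmonicity T lifts to a
-- spanning tree T̃ of G̃. The α's are the fundamental cycles of the free cotree edges of T, the γ's
-- those of the dilated cotree edges, closed up inside their dilation component; their lifts give α̃⁺,
-- α̃⁻ = ι* α̃⁺ and γ̃. The remaining cotree edges of T̃ lie over the free parent edges of the tops of
-- the dilation components other than that of r, and each such top t gives β̃ = ι* Y - Y, where Y is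
-- the path in T̃ from a lift of t to the next dilated vertex. Each family is a basis because it has
-- dual functionals (evaluations at cotree edges, corrected for β̃) and a cycle vanishing on all
-- cotree edges vanishes. Counting the edges of T and of the dilation forest gives a, b, c = A, B, C.

module Submission where

open import Defs
open import Data.Nat as ℕ using (ℕ; zero; suc; _≤_; _<_; z≤n; s≤s)
import Data.Nat.Properties as NP
open import Data.Integer as ℤ using (ℤ; +_; _+_; _-_; _*_; -_)
import Data.Integer.Properties as ZP
open import Data.Integer.Tactic.RingSolver
open import Data.Fin using (Fin; zero; suc; _≟_; splitAt; _↑ˡ_; _↑ʳ_)
import Data.Fin.Properties as FP
open import Data.Bool using (Bool; true; false; if_then_else_; _∧_; _∨_; not)
import Data.Bool.Properties as BP
open import Data.Product using (Σ; ∃; ∃-syntax; _×_; _,_; proj₁; proj₂)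
open import Data.Sum using (_⊎_; inj₁; inj₂; [_,_]′)
open import Function using (_∘_; id; Equivalence)
open import Relation.Nullary using (¬_; Dec; yes; no; does)
open import Relation.Nullary.Decidable using (dec-true; dec-false; _×-dec_)
open import Relation.Binary.PropositionalEquality
open import Data.Empty using (⊥; ⊥-elim)
import Data.Empty.Irrelevant as IR
import Algebra.Properties.CommutativeSemigroup NP.+-commutativeSemigroup as ℕ-CS

[≟']-true : ∀ {n} {x y : Fin n} → [ x ≟' y ] ≡ true → x ≡ y
[≟']-true {x = x} {y} h with x ≟ y
... | yes x≡y = x≡y

[≟']-≡ : ∀ {n} {x y : Fin n} → x ≡ y → [ x ≟' y ] ≡ true
[≟']-≡ {x = x} {y} = dec-true (x ≟ y)

[≟']-refl : ∀ {n} (x : Fin n) → [ x ≟' x ] ≡ true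
[≟']-refl x = [≟']-≡ {x = x} refl

[≟']-≢ : ∀ {n} {x y : Fin n} → x ≢ y → [ x ≟' y ] ≡ false
[≟']-≢ {x = x} {y} = dec-false (x ≟ y)

does-true : ∀ {A : Set} (a? : Dec A) → does a? ≡ true → A
does-true (yes a) _ = a

does-false : ∀ {A : Set} (a? : Dec A) → does a? ≡ false → ¬ A
does-false (no ¬a) _ = ¬a

∧-true : ∀ {x y} → x ∧ y ≡ true → x ≡ true × y ≡ true
∧-true {true} {true} _ = refl , refl

not-true : ∀ {x} → not x ≡ true → x ≡ false
not-true {false} _ = refl

not-false : ∀ {x} → not x ≡ false → x ≡ true
not-false {true} _ = refl

true≢false : true ≢ false
true≢false ()

cong-irr : ∀ {A : Set} {n} {P : Fin n → Set} (g : ∀ j → .(P j) → A) {a b : Fin n} →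
  a ≡ b → {ha : P a} {hb : P b} → g a ha ≡ g b hb
cong-irr g refl = refl

ΣZ-cong : ∀ {n} {f g : Fin n → ℤ} → (∀ i → f i ≡ g i) → ΣZ f ≡ ΣZ g
ΣZ-cong {zero} f≡g = refl
ΣZ-cong {suc n} f≡g = cong₂ _+_ (f≡g zero) (ΣZ-cong (f≡g ∘ suc))

ΣZ-zero : ∀ {n} {f : Fin n → ℤ} → (∀ i → f i ≡ + 0) → ΣZ f ≡ + 0
ΣZ-zero {zero} f≡0 = refl
ΣZ-zero {suc n} f≡0 = cong₂ _+_ (f≡0 zero) (ΣZ-zero (f≡0 ∘ suc))

ΣZ-distrib-+ : ∀ {n} (f g : Fin n → ℤ) → ΣZ (λ i → f i + g i) ≡ ΣZ f + ΣZ g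
ΣZ-distrib-+ {zero} f g = refl
ΣZ-distrib-+ {suc n} f g
  rewrite ΣZ-distrib-+ (f ∘ suc) (g ∘ suc) = interchange (f zero) (g zero) (ΣZ (f ∘ suc)) (ΣZ (g ∘ suc))
  where
  interchange : ∀ a b c d → a + b + (c + d) ≡ a + c + (b + d)
  interchange = solve-∀

ΣZ-*ˡ : ∀ {n} (k : ℤ) (f : Fin n → ℤ) → ΣZ (λ i → k * f i) ≡ k * ΣZ f
ΣZ-*ˡ {zero} k f = sym (ZP.*-zeroʳ k)
ΣZ-*ˡ {suc n} k f rewrite ΣZ-*ˡ k (f ∘ suc) = sym (ZP.*-distribˡ-+ k (f zero) (ΣZ (f ∘ suc)))

ΣZ-neg : ∀ {n} (f : Fin n → ℤ) → ΣZ (λ i → - f i) ≡ - ΣZ f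
ΣZ-neg {zero} f = refl
ΣZ-neg {suc n} f rewrite ΣZ-neg (f ∘ suc) = sym (ZP.neg-distrib-+ (f zero) (ΣZ (f ∘ suc)))

ΣZ-distrib-- : ∀ {n} (f g : Fin n → ℤ) → ΣZ (λ i → f i - g i) ≡ ΣZ f - ΣZ g
ΣZ-distrib-- f g = trans (ΣZ-distrib-+ f (λ i → - g i)) (cong (λ s → ΣZ f + s) (ΣZ-neg g))

ΣZ-comm : ∀ {n m} (f : Fin n → Fin m → ℤ) →
  ΣZ (λ i → ΣZ (λ j → f i j)) ≡ ΣZ (λ j → ΣZ (λ i → f i j))
ΣZ-comm {zero} {m} f = sym (ΣZ-zero {m} (λ j → refl))
ΣZ-comm {suc n} {m} f =
  trans (cong (λ s → ΣZ (f zero) + s) (ΣZ-comm (f ∘ suc)))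
        (sym (ΣZ-distrib-+ (f zero) (λ j → ΣZ (λ i → f (suc i) j))))

ΣZ-single : ∀ {n} (f : Fin n → ℤ) (j : Fin n) → (∀ i → i ≢ j → f i ≡ + 0) → ΣZ f ≡ f j
ΣZ-single {suc n} f zero f≡0
  rewrite ΣZ-zero {n} {f ∘ suc} (λ i → f≡0 (suc i) (λ ())) = ZP.+-identityʳ (f zero)
ΣZ-single {suc n} f (suc j) f≡0
  rewrite f≡0 zero (λ ()) | ΣZ-single (f ∘ suc) j (λ i i≢j → f≡0 (suc i) (i≢j ∘ FP.suc-injective))
  = ZP.+-identityˡ (f (suc j))

ΣZ-pair : ∀ {n} (f : Fin n → ℤ) (j k : Fin n) → j ≢ k →
  (∀ i → i ≢ j → i ≢ k → f i ≡ + 0) → ΣZ f ≡ f j + f k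
ΣZ-pair {n} f j k j≢k f≡0 = begin
  ΣZ f                    ≡⟨ ΣZ-cong (λ i → sym (split i)) ⟩
  ΣZ (λ i → fⱼ i + fᵣ i)  ≡⟨ ΣZ-distrib-+ fⱼ fᵣ ⟩
  ΣZ fⱼ + ΣZ fᵣ           ≡⟨ cong₂ _+_ (ΣZ-single fⱼ j fⱼ≡0) (ΣZ-single fᵣ k fᵣ≡0) ⟩
  fⱼ j + fᵣ k             ≡⟨ cong₂ _+_ (cong (λ b → if b then f j else + 0) ([≟']-refl j))
                                       (cong (λ b → if b then + 0 else f k) ([≟']-≢ (j≢k ∘ sym))) ⟩
  f j + f k               ∎
  where
  open ≡-Reasoning
  fⱼ fᵣ : Fin n → ℤ
  fⱼ i = if [ i ≟' j ] then f i else + 0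
  fᵣ i = if [ i ≟' j ] then + 0 else f i
  split : ∀ i → fⱼ i + fᵣ i ≡ f i
  split i with i ≟ j
  ... | yes _ = ZP.+-identityʳ (f i)
  ... | no _  = ZP.+-identityˡ (f i)
  fⱼ≡0 : ∀ i → i ≢ j → fⱼ i ≡ + 0
  fⱼ≡0 i i≢j rewrite [≟']-≢ i≢j = refl
  fᵣ≡0 : ∀ i → i ≢ k → fᵣ i ≡ + 0
  fᵣ≡0 i i≢k with i ≟ j
  ... | yes _   = refl
  ... | no i≢j  = f≡0 i i≢j i≢k

δ : ∀ {n} → Fin n → Fin n → ℤ
δ i j = ind [ i ≟' j ]

δ-refl : ∀ {n} (i : Fin n) → δ i i ≡ + 1
δ-refl i = cong ind ([≟']-refl i)

δ-≢ : ∀ {n} {i j : Fin n} → i ≢ j → δ i j ≡ + 0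
δ-≢ i≢j = cong ind ([≟']-≢ i≢j)

δ-sym : ∀ {n} (i j : Fin n) → δ i j ≡ δ j i
δ-sym i j with i ≟ j
... | yes refl = sym (δ-refl i)
... | no i≢j   = sym (δ-≢ (i≢j ∘ sym))

δ-injective : ∀ {n m} (f : Fin n → Fin m) → (∀ {x y} → f x ≡ f y → x ≡ y) → ∀ x y → δ (f x) (f y) ≡ δ x y
δ-injective f f-inj x y with x ≟ y
... | yes refl = δ-refl (f x)
... | no x≢y   = δ-≢ (x≢y ∘ f-inj)

ΣZ-δˡ : ∀ {n} (f : Fin n → ℤ) (j : Fin n) → ΣZ (λ i → δ j i * f i) ≡ f j
ΣZ-δˡ f j = trans (ΣZ-single _ j (λ i i≢j → cong (_* f i) (δ-≢ (i≢j ∘ sym))))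
                  (trans (cong (_* f j) (δ-refl j)) (ZP.*-identityˡ (f j)))

ΣZ-δʳ : ∀ {n} (f : Fin n → ℤ) (j : Fin n) → ΣZ (λ i → f i * δ i j) ≡ f j
ΣZ-δʳ f j = trans (ΣZ-cong (λ i → trans (ZP.*-comm (f i) (δ i j)) (cong (_* f i) (δ-sym i j)))) (ΣZ-δˡ f j)

ΣZ-reindex-involution : ∀ {n} (σ : Fin n → Fin n) → (∀ i → σ (σ i) ≡ i) → (f : Fin n → ℤ) →
  ΣZ (λ i → f (σ i)) ≡ ΣZ f
ΣZ-reindex-involution {n} σ σσ≡id f = begin
  ΣZ (λ i → f (σ i))                          ≡⟨ ΣZ-cong (λ i → sym (ΣZ-δʳ f (σ i))) ⟩
  ΣZ (λ i → ΣZ (λ j → f j * δ j (σ i)))       ≡⟨ ΣZ-comm (λ i j → f j * δ j (σ i)) ⟩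
  ΣZ (λ j → ΣZ (λ i → f j * δ j (σ i)))       ≡⟨ ΣZ-cong (λ j → ΣZ-*ˡ (f j) (λ i → δ j (σ i))) ⟩
  ΣZ (λ j → f j * ΣZ (λ i → δ j (σ i)))       ≡⟨ ΣZ-cong (λ j → cong (f j *_) (hits-once j)) ⟩
  ΣZ (λ j → f j * + 1)                        ≡⟨ ΣZ-cong (λ j → ZP.*-identityʳ (f j)) ⟩
  ΣZ f                                        ∎
  where
  open ≡-Reasoning
  hits-once : ∀ j → ΣZ (λ i → δ j (σ i)) ≡ + 1
  hits-once j = trans (ΣZ-single _ (σ j) (λ i i≢σj → δ-≢ (λ j≡σi → i≢σj (trans (sym (σσ≡id i)) (cong σ (sym j≡σi))))))
                      (trans (cong (δ j) (σσ≡id j)) (δ-refl j))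

ΣN-cong : ∀ {n} {f g : Fin n → ℕ} → (∀ i → f i ≡ g i) → ΣN f ≡ ΣN g
ΣN-cong {zero} f≡g = refl
ΣN-cong {suc n} f≡g = cong₂ ℕ._+_ (f≡g zero) (ΣN-cong (f≡g ∘ suc))

ΣN-distrib-+ : ∀ {n} (f g : Fin n → ℕ) → ΣN (λ i → f i ℕ.+ g i) ≡ ΣN f ℕ.+ ΣN g
ΣN-distrib-+ {zero} f g = refl
ΣN-distrib-+ {suc n} f g
  rewrite ΣN-distrib-+ (f ∘ suc) (g ∘ suc) = ℕ-CS.interchange (f zero) (g zero) (ΣN (f ∘ suc)) (ΣN (g ∘ suc))

ΣN-positive-term : ∀ {n} (f : Fin n → ℕ) → 1 ≤ ΣN f → ∃[ i ] (1 ≤ f i)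
ΣN-positive-term {suc n} f pos with f zero in eq
... | suc _ = zero , subst (1 ≤_) (sym eq) (s≤s z≤n)
... | zero with ΣN-positive-term (f ∘ suc) pos
...   | i , fi-pos = suc i , fi-pos

erase : ∀ {n} → (Fin n → ℕ) → Fin n → Fin n → ℕ
erase f i j = if [ j ≟' i ] then 0 else f j

erase-≢ : ∀ {n} (f : Fin n → ℕ) {i j : Fin n} → j ≢ i → erase f i j ≡ f j
erase-≢ f j≢i rewrite [≟']-≢ j≢i = refl

ΣN-erase : ∀ {n} (f : Fin n → ℕ) (i : Fin n) → ΣN f ≡ f i ℕ.+ ΣN (erase f i)
ΣN-erase {suc n} f zero = refl
ΣN-erase {suc n} f (suc i) rewrite ΣN-erase (f ∘ suc) i = ℕ-CS.x∙yz≈y∙xz (f zero) (f (suc i)) _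

ΣN-term≤ : ∀ {n} (f : Fin n → ℕ) (i : Fin n) → f i ≤ ΣN f
ΣN-term≤ f i = subst (f i ≤_) (sym (ΣN-erase f i)) (NP.m≤m+n (f i) _)

ΣN-pair≤ : ∀ {n} (f : Fin n → ℕ) {i j : Fin n} → i ≢ j → f i ℕ.+ f j ≤ ΣN f
ΣN-pair≤ f {i} {j} i≢j = subst (f i ℕ.+ f j ≤_) (sym (ΣN-erase f i))
  (NP.+-monoʳ-≤ (f i) (subst (_≤ ΣN (erase f i)) (erase-≢ f (i≢j ∘ sym)) (ΣN-term≤ (erase f i) j)))

ΣN-triple≤ : ∀ {n} (f : Fin n → ℕ) {i j k : Fin n} → i ≢ j → i ≢ k → j ≢ k → f i ℕ.+ (f j ℕ.+ f k) ≤ ΣN f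
ΣN-triple≤ f {i} {j} {k} i≢j i≢k j≢k = subst (f i ℕ.+ (f j ℕ.+ f k) ≤_) (sym (ΣN-erase f i))
  (NP.+-monoʳ-≤ (f i) (subst (_≤ ΣN (erase f i))
    (cong₂ ℕ._+_ (erase-≢ f (i≢j ∘ sym)) (erase-≢ f (i≢k ∘ sym))) (ΣN-pair≤ (erase f i) j≢k)))

-- Finite decidable subsets, their cardinality and an enumeration of their elements

bit : Bool → ℕ
bit b = if b then 1 else 0

count : ∀ {n} → (Fin n → Bool) → ℕ
count p = ΣN (bit ∘ p)

enum : ∀ {n} (p : Fin n → Bool) → Fin (count p) → Fin n
enum {suc n} p k with p zero
enum {suc n} p zero    | true  = zero
enum {suc n} p (suc k) | true  = suc (enum (p ∘ suc) k)
enum {suc n} p k       | false = suc (enum (p ∘ suc) k)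

enum-member : ∀ {n} (p : Fin n → Bool) (k : Fin (count p)) → p (enum p k) ≡ true
enum-member {suc n} p k with p zero in eq
enum-member {suc n} p zero    | true  = eq
enum-member {suc n} p (suc k) | true  = enum-member (p ∘ suc) k
enum-member {suc n} p k       | false = enum-member (p ∘ suc) k

enum-injective : ∀ {n} (p : Fin n → Bool) {k k' : Fin (count p)} → enum p k ≡ enum p k' → k ≡ k'
enum-injective {suc n} p {k} {k'} eq with p zero
enum-injective {suc n} p {zero}  {zero}   eq | true  = refl
enum-injective {suc n} p {zero}  {suc _}  () | true
enum-injective {suc n} p {suc _} {zero}   () | true
enum-injective {suc n} p {suc k} {suc k'} eq | true  = cong suc (enum-injective (p ∘ suc) (FP.suc-injective eq))
enum-injective {suc n} p {k}     {k'}     eq | false = enum-injective (p ∘ suc) (FP.suc-injective eq)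

enum-surjective : ∀ {n} (p : Fin n → Bool) (i : Fin n) → p i ≡ true → Σ (Fin (count p)) (λ k → enum p k ≡ i)
enum-surjective {suc n} p i pi with p zero in eq
enum-surjective {suc n} p zero    pi | true  = zero , refl
enum-surjective {suc n} p (suc i) pi | true with enum-surjective (p ∘ suc) i pi
... | k , eₖ = suc k , cong suc eₖ
enum-surjective {suc n} p zero    pi | false = ⊥-elim (true≢false (trans (sym pi) eq))
enum-surjective {suc n} p (suc i) pi | false with enum-surjective (p ∘ suc) i pi
... | k , eₖ = k , cong suc eₖ

index : ∀ {n} (p : Fin n → Bool) (i : Fin n) → p i ≡ true → Fin (count p)
index p i pi = proj₁ (enum-surjective p i pi)

enum-index : ∀ {n} (p : Fin n → Bool) (i : Fin n) (pi : p i ≡ true) → enum p (index p i pi) ≡ i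
enum-index p i pi = proj₂ (enum-surjective p i pi)

count-cong : ∀ {n} {p q : Fin n → Bool} → (∀ i → p i ≡ q i) → count p ≡ count q
count-cong p≡q = ΣN-cong (cong bit ∘ p≡q)

count-split : ∀ {n} (p q : Fin n → Bool) → count p ≡ count (λ i → p i ∧ q i) ℕ.+ count (λ i → p i ∧ not (q i))
count-split {zero} p q = refl
count-split {suc n} p q rewrite count-split (p ∘ suc) (q ∘ suc) = split-head (p zero) (q zero)
  where
  q′ = q ∘ suc
  split-head : ∀ b c → bit b ℕ.+ (count (λ i → p (suc i) ∧ q′ i) ℕ.+ count (λ i → p (suc i) ∧ not (q′ i)))
    ≡ bit (b ∧ c) ℕ.+ count (λ i → p (suc i) ∧ q′ i) ℕ.+ (bit (b ∧ not c) ℕ.+ count (λ i → p (suc i) ∧ not (q′ i)))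
  split-head false c     = refl
  split-head true  true  = refl
  split-head true  false = sym (NP.+-suc _ _)

count-all : ∀ n → count {n} (λ _ → true) ≡ n
count-all zero    = refl
count-all (suc n) = cong suc (count-all n)

count-singleton : ∀ {n} (j : Fin n) → count (λ i → [ i ≟' j ]) ≡ 1
count-singleton {suc n} zero = cong suc (count-none n)
  where
  count-none : ∀ n → count {n} (λ _ → false) ≡ 0
  count-none zero    = refl
  count-none (suc n) = count-none n
count-singleton {suc n} (suc j) = count-singleton j

count≤size : ∀ {n} (p : Fin n → Bool) → count p ≤ n
count≤size {zero} p = z≤n
count≤size {suc n} p with p zero
... | true  = s≤s (count≤size (p ∘ suc))
... | false = NP.m≤n⇒m≤1+n (count≤size (p ∘ suc))

count-insert : ∀ {n} (p : Fin n → Bool) (x : Fin n) → p x ≡ false →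
  count (λ v → p v ∨ [ v ≟' x ]) ≡ suc (count p)
count-insert {n} p x px = begin
  count (λ v → p v ∨ [ v ≟' x ])             ≡⟨ ΣN-cong bit-∨ ⟩
  ΣN (λ v → bit (p v) ℕ.+ bit [ v ≟' x ])     ≡⟨ ΣN-distrib-+ (bit ∘ p) (λ v → bit [ v ≟' x ]) ⟩
  count p ℕ.+ count (λ v → [ v ≟' x ])       ≡⟨ cong (count p ℕ.+_) (count-singleton x) ⟩
  count p ℕ.+ 1                              ≡⟨ NP.+-comm (count p) 1 ⟩
  suc (count p)                              ∎
  where
  open ≡-Reasoning
  bit-∨ : ∀ v → bit (p v ∨ [ v ≟' x ]) ≡ bit (p v) ℕ.+ bit [ v ≟' x ]
  bit-∨ v with v ≟ x
  ... | yes refl rewrite px = refl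
  ... | no _ with p v
  ...   | true  = refl
  ...   | false = refl

-- The maps may depend on membership proofs only irrelevantly, as a tree's parent edge does.
count-mono : ∀ {n m} (p : Fin n → Bool) (q : Fin m → Bool) (f : ∀ i → .(p i ≡ true) → Fin m) →
  (∀ i (pi : p i ≡ true) → q (f i pi) ≡ true) →
  (∀ i j (pi : p i ≡ true) (pj : p j ≡ true) → f i pi ≡ f j pj → i ≡ j) → count p ≤ count q
count-mono p q f pq f-inj = FP.injective⇒≤ {f = g} g-inj
  where
  g : Fin (count p) → Fin (count q)
  g k = index q (f (enum p k) (enum-member p k)) (pq _ (enum-member p k))
  g-inj : ∀ {k k'} → g k ≡ g k' → k ≡ k'
  g-inj {k} {k'} eq = enum-injective p (f-inj _ _ (enum-member p k) (enum-member p k')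
    (trans (sym (enum-index q _ (pq _ (enum-member p k))))
      (trans (cong (enum q) eq) (enum-index q _ (pq _ (enum-member p k'))))))

count-bij : ∀ {n m} (p : Fin n → Bool) (q : Fin m → Bool)
  (f : ∀ i → .(p i ≡ true) → Fin m) (g : ∀ j → .(q j ≡ true) → Fin n) →
  (pq : ∀ i (pi : p i ≡ true) → q (f i pi) ≡ true) → (qp : ∀ j (qj : q j ≡ true) → p (g j qj) ≡ true) →
  (∀ i (pi : p i ≡ true) → g (f i pi) (pq i pi) ≡ i) → (∀ j (qj : q j ≡ true) → f (g j qj) (qp j qj) ≡ j) →
  count p ≡ count q
count-bij p q f g pq qp gf≡id fg≡id = NP.≤-antisym
  (count-mono p q f pq (λ i j pi pj eq → trans (sym (gf≡id i pi)) (trans (cong-irr g eq {pq i pi} {pq j pj}) (gf≡id j pj))))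
  (count-mono q p g qp (λ i j qi qj eq → trans (sym (fg≡id i qi)) (trans (cong-irr f eq {qp i qi} {qp j qj}) (fg≡id j qj))))

-- Chains, boundaries and a dual-basis criterion for H₁

⟨_,_⟩ : ∀ {n} → (Fin n → ℤ) → (Fin n → ℤ) → ℤ
⟨ w , x ⟩ = ΣZ (λ i → w i * x i)

⟨⟩-distrib-+ : ∀ {n} (w x y : Fin n → ℤ) → ⟨ w , (λ i → x i + y i) ⟩ ≡ ⟨ w , x ⟩ + ⟨ w , y ⟩
⟨⟩-distrib-+ {n} w x y = trans (ΣZ-cong {n} (λ i → ZP.*-distribˡ-+ (w i) (x i) (y i))) (ΣZ-distrib-+ {n} _ _)

⟨⟩-distrib-- : ∀ {n} (w x y : Fin n → ℤ) → ⟨ w , (λ i → x i - y i) ⟩ ≡ ⟨ w , x ⟩ - ⟨ w , y ⟩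
⟨⟩-distrib-- {n} w x y = trans (ΣZ-cong {n} (λ i → *-distrib-- (w i) (x i) (y i))) (ΣZ-distrib-- {n} _ _)
  where
  *-distrib-- : ∀ a b c → a * (b - c) ≡ a * b - a * c
  *-distrib-- = solve-∀

⟨⟩-scale : ∀ {n} (w : Fin n → ℤ) (k : ℤ) (x : Fin n → ℤ) → ⟨ w , (λ i → k * x i) ⟩ ≡ k * ⟨ w , x ⟩
⟨⟩-scale {n} w k x = trans (ΣZ-cong {n} (λ i → *-left-comm (w i) k (x i))) (ΣZ-*ˡ {n} k _)
  where
  *-left-comm : ∀ a b c → a * (b * c) ≡ b * (a * c)
  *-left-comm = solve-∀

⟨⟩-zero : ∀ {n} (w x : Fin n → ℤ) → (∀ i → x i ≡ + 0) → ⟨ w , x ⟩ ≡ + 0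
⟨⟩-zero {n} w x x≡0 = ΣZ-zero {n} (λ i → trans (cong (w i *_) (x≡0 i)) (ZP.*-zeroʳ (w i)))

⟨⟩-comm : ∀ {n} (w x : Fin n → ℤ) → ⟨ w , x ⟩ ≡ ⟨ x , w ⟩
⟨⟩-comm {n} w x = ΣZ-cong {n} (λ i → ZP.*-comm (w i) (x i))

⟨δ,⟩ : ∀ {n} (a : Fin n) (x : Fin n → ℤ) → ⟨ δ a , x ⟩ ≡ x a
⟨δ,⟩ a x = ΣZ-δˡ x a

⟨,δ⟩ : ∀ {n} (w : Fin n → ℤ) (a : Fin n) → ⟨ w , δ a ⟩ ≡ w a
⟨,δ⟩ w a = trans (ΣZ-cong (λ i → cong (w i *_) (δ-sym a i))) (ΣZ-δʳ w a)

⟨⟩-lincomb : ∀ {G r} (w : Chain G) (c : Fin r → ℤ) (b : Fin r → Chain G) →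
  ⟨ w , lincomb {G} c b ⟩ ≡ ΣZ (λ i → c i * ⟨ w , b i ⟩)
⟨⟩-lincomb {G} {r} w c b = begin
  ΣZ (λ e → w e * ΣZ (λ i → c i * b i e))      ≡⟨ ΣZ-cong {nE G} (λ e → sym (ΣZ-*ˡ {r} (w e) _)) ⟩
  ΣZ (λ e → ΣZ (λ i → w e * (c i * b i e)))    ≡⟨ ΣZ-comm {nE G} {r} _ ⟩
  ΣZ (λ i → ΣZ (λ e → w e * (c i * b i e)))    ≡⟨ ΣZ-cong (λ i → ⟨⟩-scale w (c i) (b i)) ⟩
  ΣZ (λ i → c i * ⟨ w , b i ⟩)                 ∎
  where open ≡-Reasoning

-- ∂ H z v is, definitionally, the pairing of z with the incidence vector of v.
incidence : (H : Graph) → Vtx H → Chain H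
incidence H v e = δ (tgt H e) v - δ (src H e) v

∂-distrib-+ : ∀ (H : Graph) x y v → ∂ H (λ e → x e + y e) v ≡ ∂ H x v + ∂ H y v
∂-distrib-+ H x y v = ⟨⟩-distrib-+ (incidence H v) x y

∂-distrib-- : ∀ (H : Graph) x y v → ∂ H (λ e → x e - y e) v ≡ ∂ H x v - ∂ H y v
∂-distrib-- H x y v = ⟨⟩-distrib-- (incidence H v) x y

∂-edge : ∀ (H : Graph) a v → ∂ H (δ a) v ≡ incidence H v a
∂-edge H a v = ⟨,δ⟩ (incidence H v) a

basis-from-dual : ∀ (H : Graph) {r} (b w : Fin r → Chain H) →
  (∀ i → IsCycle H (b i)) →
  (∀ j i → ⟨ w j , b i ⟩ ≡ δ j i) →
  (∀ z → IsCycle H z → (∀ j → ⟨ w j , z ⟩ ≡ + 0) → ∀ e → z e ≡ + 0) →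
  IsBasis H b
basis-from-dual H {r} b w b-cycle dual detects = b-cycle , span , independent
  where
  coordinates : ∀ j c → ⟨ w j , lincomb {H} c b ⟩ ≡ c j
  coordinates j c = trans (⟨⟩-lincomb {H} (w j) c b)
    (trans (ΣZ-cong {r} (λ i → trans (cong (c i *_) (dual j i)) (ZP.*-comm (c i) (δ j i)))) (ΣZ-δˡ c j))
  span : ∀ z → IsCycle H z → ∃[ c ] (lincomb {H} c b ≈[ H ] z)
  span z z-cycle = c , λ e → sym (ZP.i-j≡0⇒i≡j (z e) _ (detects rest rest-cycle rest-dual e))
    where
    c : Fin r → ℤ
    c j = ⟨ w j , z ⟩
    rest : Chain H
    rest e = z e - lincomb {H} c b e
    rest-cycle : IsCycle H rest
    rest-cycle v = begin
      ∂ H rest v                             ≡⟨ ∂-distrib-- H z _ v ⟩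
      ∂ H z v - ∂ H (lincomb {H} c b) v      ≡⟨ cong₂ _-_ (z-cycle v) (⟨⟩-lincomb {H} (incidence H v) c b) ⟩
      + 0 - ΣZ (λ i → c i * ∂ H (b i) v)      ≡⟨ cong (λ s → + 0 - s) (ΣZ-zero {r} (λ i → trans (cong (c i *_) (b-cycle i v)) (ZP.*-zeroʳ (c i)))) ⟩
      + 0                                    ∎
      where open ≡-Reasoning
    rest-dual : ∀ j → ⟨ w j , rest ⟩ ≡ + 0
    rest-dual j = trans (⟨⟩-distrib-- (w j) z _) (trans (cong (λ s → c j - s) (coordinates j c)) (ZP.+-inverseʳ (c j)))
  independent : ∀ c → lincomb {H} c b ≈[ H ] 0ᶜ H → ∀ i → c i ≡ + 0
  independent c c≈0 i = trans (sym (coordinates i c)) (⟨⟩-zero (w i) _ c≈0)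

-- Rooted spanning trees and paths towards a set of stopping vertices

end : {H : Graph} → Bool → Edg H → Vtx H
end {H} true  e = tgt H e
end {H} false e = src H e

end-incident : ∀ {H : Graph} b e {u} → end {H} b e ≡ u → tgt H e ≡ u ⊎ src H e ≡ u
end-incident true  e eq = inj₁ eq
end-incident false e eq = inj₂ eq

other-end : ∀ {H : Graph} e b {w u} → end {H} b e ≡ w → tgt H e ≡ u ⊎ src H e ≡ u → u ≢ w → end {H} (not b) e ≡ u
other-end e true  eq (inj₁ tgt≡u) u≢w = ⊥-elim (u≢w (trans (sym tgt≡u) eq))
other-end e true  eq (inj₂ src≡u) u≢w = src≡u
other-end e false eq (inj₁ tgt≡u) u≢w = tgt≡u
other-end e false eq (inj₂ src≡u) u≢w = ⊥-elim (u≢w (trans (sym src≡u) eq))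

sgn : Bool → ℤ
sgn true  = + 1
sgn false = - + 1

sgn-cancel : ∀ b x → sgn b * x ≡ + 0 → x ≡ + 0
sgn-cancel true  x eq = trans (sym (ZP.*-identityˡ x)) eq
sgn-cancel false x eq = trans (sym (ZP.neg-involutive x)) (cong -_ (trans (sym (ZP.-1*i≡-i x)) eq))

sgn-squared : ∀ b → sgn b * sgn b ≡ + 1
sgn-squared true  = refl
sgn-squared false = refl

sgn-incidence : ∀ (H : Graph) e b u → sgn b * incidence H u e ≡ δ (end {H} b e) u - δ (end {H} (not b) e) u
sgn-incidence H e true  u = ZP.*-identityˡ _
sgn-incidence H e false u = trans (ZP.-1*i≡-i _) (neg-flip (δ (tgt H e) u) (δ (src H e) u))
  where
  neg-flip : ∀ a b → - (a - b) ≡ b - a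
  neg-flip = solve-∀

incidence-end : ∀ (H : Graph) e v b → end {H} b e ≡ v → end {H} (not b) e ≢ v → incidence H v e ≡ sgn b
incidence-end H e v true  ≡v ≢v rewrite [≟']-≡ ≡v | [≟']-≢ ≢v = refl
incidence-end H e v false ≡v ≢v rewrite [≟']-≡ ≡v | [≟']-≢ ≢v = refl

incidence-away : ∀ (H : Graph) e v → tgt H e ≢ v → src H e ≢ v → incidence H v e ≡ + 0
incidence-away H e v tgt≢v src≢v rewrite [≟']-≢ tgt≢v | [≟']-≢ src≢v = refl

record RootedTree (H : Graph) : Set where
  field
    root    : Vtx H
    par     : (v : Vtx H) → .(v ≢ root) → Edg H
    dir     : Vtx H → Bool
    depth   : Vtx H → ℕ
    par-end : ∀ v (v≢root : v ≢ root) → end {H} (dir v) (par v v≢root) ≡ v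
    parent-shallower : ∀ v (v≢root : v ≢ root) → depth (end {H} (not (dir v)) (par v v≢root)) < depth v

module Tree {H : Graph} (T : RootedTree H) where
  open RootedTree T

  parent : (v : Vtx H) → .(v ≢ root) → Vtx H
  parent v v≢root = end {H} (not (dir v)) (par v v≢root)

  parent≢ : ∀ v (v≢root : v ≢ root) → parent v v≢root ≢ v
  parent≢ v v≢root eq = NP.<-irrefl (cong depth eq) (parent-shallower v v≢root)

  incidence-par : ∀ v (v≢root : v ≢ root) → incidence H v (par v v≢root) ≡ sgn (dir v)
  incidence-par v v≢root = incidence-end H (par v v≢root) v (dir v) (par-end v v≢root) (parent≢ v v≢root)

  par-cong : ∀ {v w} (v≡w : v ≡ w) (v≢root : v ≢ root) (w≢root : w ≢ root) → par v v≢root ≡ par w w≢root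
  par-cong refl _ _ = refl

  -- The other end of a parent edge is strictly shallower, so two vertices cannot share one.
  par-injective : ∀ v w (v≢root : v ≢ root) (w≢root : w ≢ root) → par v v≢root ≡ par w w≢root → v ≡ w
  par-injective v w v≢root w≢root eq with v ≟ w
  ... | yes v≡w = v≡w
  ... | no v≢w = ⊥-elim (NP.<-asym (subst (λ x → depth x < depth v) parent-v≡w (parent-shallower v v≢root))
                                    (subst (λ x → depth x < depth w) parent-w≡v (parent-shallower w w≢root)))
    where
    parent-w≡v : parent w w≢root ≡ v
    parent-w≡v = other-end (par w w≢root) (dir w) (par-end w w≢root)
      (end-incident (dir v) _ (subst (λ e → end {H} (dir v) e ≡ v) eq (par-end v v≢root))) v≢w
    parent-v≡w : parent v v≢root ≡ w
    parent-v≡w = other-end (par v v≢root) (dir v) (par-end v v≢root)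
      (end-incident (dir w) _ (subst (λ e → end {H} (dir w) e ≡ w) (sym eq) (par-end w w≢root))) (v≢w ∘ sym)

  IsTreeEdge : Edg H → Set
  IsTreeEdge e = ∃[ w ] Σ (w ≢ root) (λ w≢root → par w w≢root ≡ e)

  treeEdge? : ∀ e → Dec (IsTreeEdge e)
  treeEdge? e = FP.any? (λ w → parentOf? w (w ≟ root))
    where
    parentOf? : ∀ w → Dec (w ≡ root) → Dec (Σ (w ≢ root) (λ w≢root → par w w≢root ≡ e))
    parentOf? w (yes w≡root) = no (λ (w≢root , _) → w≢root w≡root)
    parentOf? w (no w≢root) with par w w≢root ≟ e
    ... | yes eq = yes (w≢root , eq)
    ... | no ≢e  = no (λ (_ , eq) → ≢e eq)

  depth-bound : ℕ
  depth-bound = suc (ΣN depth)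

  depth<bound : ∀ v → depth v < depth-bound
  depth<bound v = s≤s (ΣN-term≤ depth v)

  -- Leaves first: the other tree edges at v are parent edges of deeper vertices, already shown to
  -- vanish, so the cycle condition at v kills the parent edge of v.
  module _ (z : Chain H) (z-cycle : IsCycle H z) (z-off-tree : ∀ e → ¬ IsTreeEdge e → z e ≡ + 0) where

    vanishes-on-par : ∀ k v (v≢root : v ≢ root) → depth-bound ≤ depth v ℕ.+ k → z (par v v≢root) ≡ + 0
    vanishes-on-par zero v v≢root bound≤ =
      ⊥-elim (NP.<⇒≱ (depth<bound v) (subst (depth-bound ≤_) (NP.+-identityʳ (depth v)) bound≤))
    vanishes-on-par (suc k) v v≢root bound≤ = sgn-cancel (dir v) _ (begin
      sgn (dir v) * z e₀                  ≡⟨ cong (_* z e₀) (sym (incidence-par v v≢root)) ⟩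
      incidence H v e₀ * z e₀             ≡⟨ sym (ΣZ-single (λ e → incidence H v e * z e) e₀ other-terms) ⟩
      ∂ H z v                             ≡⟨ z-cycle v ⟩
      + 0                                 ∎)
      where
      open ≡-Reasoning
      e₀ = par v v≢root
      vanishes-at-v : ∀ e → e ≢ e₀ → tgt H e ≡ v ⊎ src H e ≡ v → z e ≡ + 0
      vanishes-at-v e e≢e₀ at-v with treeEdge? e
      ... | no off-tree = z-off-tree e off-tree
      ... | yes (w , w≢root , refl) = vanishes-on-par k w w≢root (NP.≤-trans bound≤ deeper)
        where
        parent-w≡v : parent w w≢root ≡ v
        parent-w≡v = other-end (par w w≢root) (dir w) (par-end w w≢root) at-v
          (λ v≡w → e≢e₀ (par-cong (sym v≡w) w≢root v≢root))
        deeper : depth v ℕ.+ suc k ≤ depth w ℕ.+ k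
        deeper = subst (_≤ depth w ℕ.+ k) (sym (NP.+-suc (depth v) k))
          (NP.+-monoˡ-≤ k (subst (λ x → depth x < depth w) parent-w≡v (parent-shallower w w≢root)))
      other-terms : ∀ e → e ≢ e₀ → incidence H v e * z e ≡ + 0
      other-terms e e≢e₀ = by-incidence (tgt H e ≟ v) (src H e ≟ v)
        where
        by-incidence : Dec (tgt H e ≡ v) → Dec (src H e ≡ v) → incidence H v e * z e ≡ + 0
        by-incidence (yes tgt≡v) _ = trans (cong (incidence H v e *_) (vanishes-at-v e e≢e₀ (inj₁ tgt≡v))) (ZP.*-zeroʳ (incidence H v e))
        by-incidence (no _) (yes src≡v) = trans (cong (incidence H v e *_) (vanishes-at-v e e≢e₀ (inj₂ src≡v))) (ZP.*-zeroʳ (incidence H v e))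
        by-incidence (no tgt≢v) (no src≢v) = trans (cong (_* z e) (incidence-away H e v tgt≢v src≢v)) (ZP.*-zeroˡ (z e))

    cycle-vanishing-off-tree : ∀ e → z e ≡ + 0
    cycle-vanishing-off-tree e with treeEdge? e
    ... | no off-tree = z-off-tree e off-tree
    ... | yes (w , w≢root , refl) = vanishes-on-par depth-bound w w≢root (NP.m≤n+m depth-bound (depth w))

  -- climb k v is the chain of the tree path from v up to the first stopping vertex summit k v, using fuel k.
  module Climb (stop : Vtx H → Bool) (stop-root : stop root ≡ true) where

    moving⇒≢root : ∀ {v} → stop v ≡ false → v ≢ root
    moving⇒≢root moving v≡root = true≢false (trans (sym stop-root) (trans (cong stop (sym v≡root)) moving))

    climb : ℕ → Vtx H → Chain H
    climb-from : ℕ → (v : Vtx H) → (b : Bool) → stop v ≡ b → Chain H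
    climb zero    v = 0ᶜ H
    climb (suc k) v = climb-from k v (stop v) refl
    climb-from k v true  _ = 0ᶜ H
    climb-from k v false moving e =
      sgn (dir v) * δ (par v (moving⇒≢root moving)) e + climb k (parent v (moving⇒≢root moving)) e

    summit : ℕ → Vtx H → Vtx H
    summit-from : ℕ → (v : Vtx H) → (b : Bool) → stop v ≡ b → Vtx H
    summit zero    v = v
    summit (suc k) v = summit-from k v (stop v) refl
    summit-from k v true  _ = v
    summit-from k v false moving = summit k (parent v (moving⇒≢root moving))

    fuel-parent : ∀ {k v} (moving : stop v ≡ false) → depth v < suc k → depth (parent v (moving⇒≢root moving)) < k
    fuel-parent {v = v} moving enough = NP.<-≤-trans (parent-shallower v (moving⇒≢root moving)) (NP.≤-pred enough)

    ∂-climb : ∀ k v → depth v < k → ∀ u → ∂ H (climb k v) u ≡ δ v u - δ (summit k v) u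
    ∂-climb-from : ∀ k v b (eq : stop v ≡ b) → depth v < suc k → ∀ u →
      ∂ H (climb-from k v b eq) u ≡ δ v u - δ (summit-from k v b eq) u
    ∂-climb (suc k) v enough u = ∂-climb-from k v (stop v) refl enough u
    ∂-climb-from k v true  _ _ u =
      trans (⟨⟩-zero (incidence H u) _ (λ _ → refl)) (sym (ZP.+-inverseʳ (δ v u)))
    ∂-climb-from k v false moving enough u = begin
      ∂ H (climb-from k v false moving) u
        ≡⟨ ∂-distrib-+ H _ _ u ⟩
      ∂ H (λ e → sgn (dir v) * δ e₀ e) u + ∂ H (climb k w) u
        ≡⟨ cong₂ _+_ (⟨⟩-scale (incidence H u) (sgn (dir v)) (δ e₀)) (∂-climb k w (fuel-parent moving enough) u) ⟩
      sgn (dir v) * ∂ H (δ e₀) u + (δ w u - δ (summit k w) u)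
        ≡⟨ cong (_+ (δ w u - δ (summit k w) u)) (trans (cong (sgn (dir v) *_) (∂-edge H e₀ u))
             (trans (sgn-incidence H e₀ (dir v) u) (cong (λ x → δ x u - δ w u) (par-end v v≢root)))) ⟩
      δ v u - δ w u + (δ w u - δ (summit k w) u)
        ≡⟨ telescope (δ v u) (δ w u) (δ (summit k w) u) ⟩
      δ v u - δ (summit k w) u  ∎
      where
      open ≡-Reasoning
      v≢root = moving⇒≢root moving
      e₀ = par v v≢root
      w = parent v v≢root
      telescope : ∀ a b c → a - b + (b - c) ≡ a - c
      telescope = solve-∀

    summit-stops : ∀ k v → depth v < k → stop (summit k v) ≡ true
    summit-from-stops : ∀ k v b (eq : stop v ≡ b) → depth v < suc k → stop (summit-from k v b eq) ≡ true
    summit-stops (suc k) v enough = summit-from-stops k v (stop v) refl enough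
    summit-from-stops k v true  stops  _      = stops
    summit-from-stops k v false moving enough = summit-stops k _ (fuel-parent moving enough)

    climb-support : ∀ k v e → (∀ w (w≢root : w ≢ root) → stop w ≡ false → depth w ≤ depth v → par w w≢root ≢ e) →
      climb k v e ≡ + 0
    climb-from-support : ∀ k v b (eq : stop v ≡ b) e →
      (∀ w (w≢root : w ≢ root) → stop w ≡ false → depth w ≤ depth v → par w w≢root ≢ e) → climb-from k v b eq e ≡ + 0
    climb-support zero    v e unused = refl
    climb-support (suc k) v e unused = climb-from-support k v (stop v) refl e unused
    climb-from-support k v true  _      e unused = refl
    climb-from-support k v false moving e unused =
      cong₂ _+_ (trans (cong (sgn (dir v) *_) (δ-≢ (unused v v≢root moving NP.≤-refl))) (ZP.*-zeroʳ (sgn (dir v))))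
                (climb-support k _ e (λ w w≢root w-moving w≤ → unused w w≢root w-moving
                  (NP.≤-trans w≤ (NP.<⇒≤ (parent-shallower v v≢root)))))
      where v≢root = moving⇒≢root moving

    climb-off-tree : ∀ k v e → ¬ IsTreeEdge e → climb k v e ≡ + 0
    climb-off-tree k v e off-tree = climb-support k v e (λ w w≢root _ _ eq → off-tree (w , w≢root , eq))

    climb-unfold : ∀ k v (moving : stop v ≡ false) e →
      climb (suc k) v e ≡ sgn (dir v) * δ (par v (moving⇒≢root moving)) e + climb k (parent v (moving⇒≢root moving)) e
    climb-unfold k v moving e = unfold-from (stop v) refl moving
      where
      unfold-from : ∀ b (eq : stop v ≡ b) (moving′ : stop v ≡ false) → climb-from k v b eq e ≡
        sgn (dir v) * δ (par v (moving⇒≢root moving′)) e + climb k (parent v (moving⇒≢root moving′)) e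
      unfold-from true  stops moving′ = ⊥-elim (true≢false (trans (sym stops) moving′))
      unfold-from false _     _       = refl

    summit-invariant : (Q : Vtx H → Set) → (∀ v (moving : stop v ≡ false) → Q v → Q (parent v (moving⇒≢root moving))) →
      ∀ k v → Q v → Q (summit k v)
    summit-from-invariant : (Q : Vtx H → Set) → (∀ v (moving : stop v ≡ false) → Q v → Q (parent v (moving⇒≢root moving))) →
      ∀ k v b (eq : stop v ≡ b) → Q v → Q (summit-from k v b eq)
    summit-invariant Q step zero    v q = q
    summit-invariant Q step (suc k) v q = summit-from-invariant Q step k v (stop v) refl q
    summit-from-invariant Q step k v true  _      q = q
    summit-from-invariant Q step k v false moving q = summit-invariant Q step k _ (step v moving q)

    summit-unique : (top : Vtx H → Vtx H) → (∀ v → stop v ≡ true → top v ≡ v) →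
      (∀ v (moving : stop v ≡ false) → top v ≡ top (parent v (moving⇒≢root moving))) →
      ∀ k v → depth v < k → summit k v ≡ top v
    summit-unique top top-stop top-step k v enough =
      trans (sym (top-stop _ (summit-stops k v enough)))
            (summit-invariant (λ w → top w ≡ top v) (λ w moving eq → trans (sym (top-step w moving)) eq) k v refl)

push : ∀ {m n} → (Fin m → Fin n) → (Fin m → ℤ) → Fin n → ℤ
push {m} f z e = ΣZ {m} (λ ẽ → if [ f ẽ ≟' e ] then z ẽ else + 0)

push-as-pairing : ∀ {m n} (f : Fin m → Fin n) z e → push f z e ≡ ⟨ (λ ẽ → δ (f ẽ) e) , z ⟩
push-as-pairing {m} f z e = ΣZ-cong {m} (λ ẽ → if-as-product [ f ẽ ≟' e ] (z ẽ))
  where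
  if-as-product : ∀ b x → (if b then x else + 0) ≡ ind b * x
  if-as-product true  x = sym (ZP.*-identityˡ x)
  if-as-product false x = sym (ZP.*-zeroˡ x)

module _ {m n} (f : Fin m → Fin n) where

  push-distrib-+ : ∀ x y e → push f (λ ẽ → x ẽ + y ẽ) e ≡ push f x e + push f y e
  push-distrib-+ x y e rewrite push-as-pairing f (λ ẽ → x ẽ + y ẽ) e
    | push-as-pairing f x e | push-as-pairing f y e = ⟨⟩-distrib-+ (λ ẽ → δ (f ẽ) e) x y

  push-distrib-- : ∀ x y e → push f (λ ẽ → x ẽ - y ẽ) e ≡ push f x e - push f y e
  push-distrib-- x y e rewrite push-as-pairing f (λ ẽ → x ẽ - y ẽ) e
    | push-as-pairing f x e | push-as-pairing f y e = ⟨⟩-distrib-- (λ ẽ → δ (f ẽ) e) x y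

  push-scale : ∀ k x e → push f (λ ẽ → k * x ẽ) e ≡ k * push f x e
  push-scale k x e rewrite push-as-pairing f (λ ẽ → k * x ẽ) e
    | push-as-pairing f x e = ⟨⟩-scale (λ ẽ → δ (f ẽ) e) k x

  push-edge : ∀ a e → push f (δ a) e ≡ δ (f a) e
  push-edge a e = trans (push-as-pairing f (δ a) e) (⟨,δ⟩ (λ ẽ → δ (f ẽ) e) a)

  push-zero : ∀ e → push f (λ _ → + 0) e ≡ + 0
  push-zero e = trans (push-as-pairing f (λ _ → + 0) e) (⟨⟩-zero (λ ẽ → δ (f ẽ) e) (λ _ → + 0) (λ _ → refl))

module PushClimb {H′ H : Graph} (T′ : RootedTree H′) (T : RootedTree H)
  (pV : Vtx H′ → Vtx H) (pE : Edg H′ → Edg H)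
  (stop : Vtx H → Bool) (stop-root : stop (RootedTree.root T) ≡ true)
  (stop-root′ : stop (pV (RootedTree.root T′)) ≡ true)
  (dir-comm : ∀ v → RootedTree.dir T′ v ≡ RootedTree.dir T (pV v))
  (par-comm : ∀ v (v≢root : v ≢ RootedTree.root T′) (pv≢root : pV v ≢ RootedTree.root T) →
     pE (RootedTree.par T′ v v≢root) ≡ RootedTree.par T (pV v) pv≢root)
  (parent-comm : ∀ v (v≢root : v ≢ RootedTree.root T′) (pv≢root : pV v ≢ RootedTree.root T) →
     pV (Tree.parent T′ v v≢root) ≡ Tree.parent T (pV v) pv≢root)
  where
  module Source = Tree.Climb T′ (stop ∘ pV) stop-root′
  module Target = Tree.Climb T stop stop-root

  push-climb : ∀ k v → push pE (Source.climb k v) ≈[ H ] Target.climb k (pV v)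
  push-climb-from : ∀ k v b (eq : stop (pV v) ≡ b) →
    push pE (Source.climb-from k v b eq) ≈[ H ] Target.climb-from k (pV v) b eq
  push-climb zero    v e = push-zero pE e
  push-climb (suc k) v e = push-climb-from k v (stop (pV v)) refl e
  push-climb-from k v true  _      e = push-zero pE e
  push-climb-from k v false moving e = begin
    push pE (Source.climb-from k v false moving) e
      ≡⟨ push-distrib-+ pE _ _ e ⟩
    push pE (λ ẽ → sgn (RootedTree.dir T′ v) * δ a ẽ) e + push pE (Source.climb k w) e
      ≡⟨ cong₂ _+_ (trans (push-scale pE (sgn (RootedTree.dir T′ v)) (δ a) e) (cong₂ _*_ (cong sgn (dir-comm v)) (push-edge pE a e)))
                   (push-climb k w e) ⟩
    sgn (RootedTree.dir T (pV v)) * δ (pE a) e + Target.climb k (pV w) e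
      ≡⟨ cong₂ (λ x y → sgn (RootedTree.dir T (pV v)) * δ x e + Target.climb k y e)
               (par-comm v v≢root pv≢root) (parent-comm v v≢root pv≢root) ⟩
    Target.climb-from k (pV v) false moving e  ∎
    where
    open ≡-Reasoning
    v≢root = Source.moving⇒≢root moving
    pv≢root = Target.moving⇒≢root moving
    a = RootedTree.par T′ v v≢root
    w = Tree.parent T′ v v≢root

  push-summit : ∀ k v → pV (Source.summit k v) ≡ Target.summit k (pV v)
  push-summit-from : ∀ k v b (eq : stop (pV v) ≡ b) → pV (Source.summit-from k v b eq) ≡ Target.summit-from k (pV v) b eq
  push-summit zero    v = refl
  push-summit (suc k) v = push-summit-from k v (stop (pV v)) refl
  push-summit-from k v true  _      = refl
  push-summit-from k v false moving =
    trans (push-summit k _) (cong (Target.summit k) (parent-comm v (Source.moving⇒≢root moving) (Target.moving⇒≢root moving)))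

-- Fibres of a double cover

weight : ∀ {n} {P : Fin n → Set} → (∀ x → Dec (P x)) → (Fin n → ℕ) → Fin n → ℕ
weight P? m x = if does (P? x) then m x else 0

-- A decidable subset whose positive weights add up to N; used with N = 2 for the fibres of
-- a double cover and with N = dV ṽ for the half-edges above a half-edge (harmonicity).
module WeightedSubset {n} {P : Fin n → Set} (P? : ∀ x → Dec (P x)) (m : Fin n → ℕ) (m-pos : ∀ x → 1 ≤ m x)
                      {N : ℕ} (total : ΣN (weight P? m) ≡ N) where

  weight-member : ∀ {x} → P x → weight P? m x ≡ m x
  weight-member {x} Px rewrite dec-true (P? x) Px = refl

  member-weight≤ : ∀ {x} → P x → m x ≤ N
  member-weight≤ {x} Px = subst₂ _≤_ (weight-member Px) total (ΣN-term≤ (weight P? m) x)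

  pair-weight≤ : ∀ {x y} → P x → P y → x ≢ y → m x ℕ.+ m y ≤ N
  pair-weight≤ Px Py x≢y =
    subst₂ _≤_ (cong₂ ℕ._+_ (weight-member Px) (weight-member Py)) total (ΣN-pair≤ (weight P? m) x≢y)

  member-exists : 1 ≤ N → ∃ P
  member-exists N-pos with ΣN-positive-term (weight P? m) (subst (1 ≤_) (sym total) N-pos)
  ... | x , x-pos = x , positive⇒member (P? x) x-pos
    where
    positive⇒member : (Px? : Dec (P x)) → 1 ≤ (if does Px? then m x else 0) → P x
    positive⇒member (yes Px) _ = Px

  unique-member : ∀ {x y} → P x → N ≤ m x → P y → y ≡ x
  unique-member {x} {y} Px N≤mx Py with y ≟ x
  ... | yes y≡x = y≡x
  ... | no y≢x = ⊥-elim (NP.<-irrefl refl (begin-strict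
    m x                 <⟨ NP.m<m+n (m x) (m-pos y) ⟩
    m x ℕ.+ m y         ≤⟨ pair-weight≤ Px Py (y≢x ∘ sym) ⟩
    N                   ≤⟨ N≤mx ⟩
    m x                 ∎))
    where open NP.≤-Reasoning

  another-member : ∀ {x} → P x → m x < N → ∃[ y ] (P y × y ≢ x)
  another-member {x} Px mx<N with ΣN-positive-term (erase (weight P? m) x) rest-pos
    where
    rest-pos : 1 ≤ ΣN (erase (weight P? m) x)
    rest-pos = NP.+-cancelˡ-≤ (m x) 1 _ (subst (m x ℕ.+ 1 ≤_)
      (trans (sym total) (trans (ΣN-erase (weight P? m) x) (cong (ℕ._+ ΣN (erase (weight P? m) x)) (weight-member Px))))
      (subst (_≤ N) (NP.+-comm 1 (m x)) mx<N))
  ... | y , y-pos = y , positive⇒other (y ≟ x) (P? y) y-pos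
    where
    positive⇒other : (y≟x : Dec (y ≡ x)) (Py? : Dec (P y)) →
      1 ≤ (if does y≟x then 0 else (if does Py? then m y else 0)) → P y × y ≢ x
    positive⇒other (no y≢x) (yes Py) _ = Py , y≢x

  at-most-two-members : N ≤ 2 → ∀ {x y z} → P x → P y → P z → x ≢ y → z ≡ x ⊎ z ≡ y
  at-most-two-members N≤2 {x} {y} {z} Px Py Pz x≢y with z ≟ x | z ≟ y
  ... | yes z≡x | _       = inj₁ z≡x
  ... | no _    | yes z≡y = inj₂ z≡y
  ... | no z≢x  | no z≢y  = ⊥-elim (NP.<⇒≱ (s≤s (s≤s (s≤s z≤n))) (begin
    3                               ≤⟨ NP.+-mono-≤ (m-pos x) (NP.+-mono-≤ (m-pos y) (m-pos z)) ⟩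
    m x ℕ.+ (m y ℕ.+ m z)           ≤⟨ subst₂ _≤_ weights total (ΣN-triple≤ (weight P? m) x≢y (z≢x ∘ sym) (z≢y ∘ sym)) ⟩
    N                               ≤⟨ N≤2 ⟩
    2                               ∎))
    where
    open NP.≤-Reasoning
    weights : weight P? m x ℕ.+ (weight P? m y ℕ.+ weight P? m z) ≡ m x ℕ.+ (m y ℕ.+ m z)
    weights = cong₂ ℕ._+_ (weight-member Px) (cong₂ ℕ._+_ (weight-member Py) (weight-member Pz))

≤2∧≢2⇒≡1 : ∀ {k} → 1 ≤ k → k ≤ 2 → k ≢ 2 → k ≡ 1
≤2∧≢2⇒≡1 {suc zero}          _ _                  _   = refl
≤2∧≢2⇒≡1 {suc (suc zero)}    _ _                  k≢2 = ⊥-elim (k≢2 refl)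
≤2∧≢2⇒≡1 {suc (suc (suc k))} _ (s≤s (s≤s ())) _

module CoverFibres {G̃ G : Graph} (π : DoubleCover G̃ G) where
  open DoubleCover π

  end-comm : ∀ b ẽ → end {G} b (πE ẽ) ≡ πV (end {G̃} b ẽ)
  end-comm true  ẽ = tgt-comm ẽ
  end-comm false ẽ = src-comm ẽ

  module FibreE (e : Edg G) = WeightedSubset (λ ẽ → πE ẽ ≟ e) dE dE-pos (degE e)
  module FibreV (v : Vtx G) = WeightedSubset (λ ṽ → πV ṽ ≟ v) dV dV-pos (degV v)

  harmonic : ∀ b ṽ e → end {G} b e ≡ πV ṽ →
    ΣN (weight (λ ẽ → (πE ẽ ≟ e) ×-dec (end {G̃} b ẽ ≟ ṽ)) dE) ≡ dV ṽ
  harmonic true  = harm-tgt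
  harmonic false = harm-src

  module Star (b : Bool) (ṽ : Vtx G̃) (e : Edg G) (at-ṽ : end {G} b e ≡ πV ṽ) =
    WeightedSubset (λ ẽ → (πE ẽ ≟ e) ×-dec (end {G̃} b ẽ ≟ ṽ)) dE dE-pos (harmonic b ṽ e at-ṽ)

  lift-edge : ∀ e → ∃[ ẽ ] πE ẽ ≡ e
  lift-edge e = FibreE.member-exists e (s≤s z≤n)

  lift-vertex : ∀ v → ∃[ ṽ ] πV ṽ ≡ v
  lift-vertex v = FibreV.member-exists v (s≤s z≤n)

  dV≤2 : ∀ ṽ → dV ṽ ≤ 2
  dV≤2 ṽ = FibreV.member-weight≤ (πV ṽ) refl

  dilE-unique : ∀ {e ẽ ẽ′} → DilE π e → πE ẽ ≡ e → πE ẽ′ ≡ e → ẽ ≡ ẽ′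
  dilE-unique (ẽ₀ , over , dil) over₁ over₂ =
    trans (FibreE.unique-member _ over (NP.≤-reflexive (sym dil)) over₁)
          (sym (FibreE.unique-member _ over (NP.≤-reflexive (sym dil)) over₂))

  dilV-unique : ∀ {v ṽ ṽ′} → DilV π v → πV ṽ ≡ v → πV ṽ′ ≡ v → ṽ ≡ ṽ′
  dilV-unique (ṽ₀ , over , dil) over₁ over₂ =
    trans (FibreV.unique-member _ over (NP.≤-reflexive (sym dil)) over₁)
          (sym (FibreV.unique-member _ over (NP.≤-reflexive (sym dil)) over₂))

  free-dV : ∀ {ṽ} → ¬ DilV π (πV ṽ) → dV ṽ ≡ 1
  free-dV {ṽ} free = ≤2∧≢2⇒≡1 (dV-pos ṽ) (dV≤2 ṽ) (λ dV≡2 → free (ṽ , refl , dV≡2))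

  lift-at : ∀ b ṽ e → end {G} b e ≡ πV ṽ → ∃[ ẽ ] (πE ẽ ≡ e × end {G̃} b ẽ ≡ ṽ)
  lift-at b ṽ e at-ṽ = Star.member-exists b ṽ e at-ṽ (dV-pos ṽ)

  lift-at-unique : ∀ b ṽ {ẽ ẽ′} → ¬ DilV π (πV ṽ) → πE ẽ ≡ πE ẽ′ →
    end {G̃} b ẽ ≡ ṽ → end {G̃} b ẽ′ ≡ ṽ → ẽ ≡ ẽ′
  lift-at-unique b ṽ {ẽ} {ẽ′} free same-image at₁ at₂ =
    Star.unique-member b ṽ (πE ẽ′) at-ṽ (refl , at₂) (subst (_≤ dE ẽ′) (sym (free-dV free)) (dE-pos ẽ′)) (same-image , at₁)
    where
    at-ṽ : end {G} b (πE ẽ′) ≡ πV ṽ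
    at-ṽ = trans (end-comm b ẽ′) (cong πV at₂)

  dilE-end : ∀ b e → DilE π e → DilV π (end {G} b e)
  dilE-end b e (ẽ₀ , over , dil) = ṽ , sym at-ṽ , NP.≤-antisym (dV≤2 ṽ) two≤dV
    where
    ṽ = end {G̃} b ẽ₀
    at-ṽ : end {G} b e ≡ πV ṽ
    at-ṽ = trans (cong (end {G} b) (sym over)) (end-comm b ẽ₀)
    two≤dV : 2 ≤ dV ṽ
    two≤dV = subst (_≤ dV ṽ) dil (Star.member-weight≤ b ṽ e at-ṽ (over , refl))

module SheetInvolution {G̃ G : Graph} (π : DoubleCover G̃ G) (ι : Edg G̃ → Edg G̃) (ι-sheet : IsSheetInvolution π ι) where
  open DoubleCover π
  open CoverFibres π

  ι-over : ∀ ẽ → πE (ι ẽ) ≡ πE ẽ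
  ι-over ẽ = proj₁ (ι-sheet ẽ)

  ι-dilated : ∀ ẽ → DilE π (πE ẽ) → ι ẽ ≡ ẽ
  ι-dilated ẽ = proj₁ (proj₂ (ι-sheet ẽ))

  ι-free : ∀ ẽ → ¬ DilE π (πE ẽ) → ι ẽ ≢ ẽ
  ι-free ẽ = proj₂ (proj₂ (ι-sheet ẽ))

  free-fibreE : ∀ {ẽ x} → ¬ DilE π (πE ẽ) → πE x ≡ πE ẽ → x ≡ ẽ ⊎ x ≡ ι ẽ
  free-fibreE {ẽ} free over =
    FibreE.at-most-two-members (πE ẽ) NP.≤-refl refl (ι-over ẽ) over (λ ẽ≡ιẽ → ι-free ẽ free (sym ẽ≡ιẽ))

  ι-involutive : ∀ ẽ → ι (ι ẽ) ≡ ẽ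
  ι-involutive ẽ with dilE? π (πE ẽ)
  ... | yes dil = trans (cong ι (ι-dilated ẽ dil)) (ι-dilated ẽ dil)
  ... | no free with free-fibreE {ẽ} {ι (ι ẽ)} free (trans (ι-over (ι ẽ)) (ι-over ẽ))
  ...   | inj₁ ιιẽ≡ẽ  = ιιẽ≡ẽ
  ...   | inj₂ ιιẽ≡ιẽ = ⊥-elim (ι-free (ι ẽ) (free ∘ subst (DilE π) (ι-over ẽ)) ιιẽ≡ιẽ)

  other-sheet : ∀ ṽ → ¬ DilV π (πV ṽ) → ∃[ ṽ′ ] (πV ṽ′ ≡ πV ṽ × ṽ′ ≢ ṽ)
  other-sheet ṽ free = FibreV.another-member (πV ṽ) {ṽ} refl (subst (_< 2) (sym (free-dV free)) (s≤s (s≤s z≤n)))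

  ιV-from : (ṽ : Vtx G̃) → Dec (DilV π (πV ṽ)) → Vtx G̃
  ιV-from ṽ (yes _)   = ṽ
  ιV-from ṽ (no free) = proj₁ (other-sheet ṽ free)

  ιV : Vtx G̃ → Vtx G̃
  ιV ṽ = ιV-from ṽ (dilV? π (πV ṽ))

  ιV-over : ∀ ṽ → πV (ιV ṽ) ≡ πV ṽ
  ιV-over ṽ with dilV? π (πV ṽ)
  ... | yes _ = refl
  ... | no free = proj₁ (proj₂ (other-sheet ṽ free))

  ιV-dilated : ∀ ṽ → DilV π (πV ṽ) → ιV ṽ ≡ ṽ
  ιV-dilated ṽ dil with dilV? π (πV ṽ)
  ... | yes _   = refl
  ... | no free = ⊥-elim (free dil)

  ιV-free : ∀ ṽ → ¬ DilV π (πV ṽ) → ιV ṽ ≢ ṽ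
  ιV-free ṽ free with dilV? π (πV ṽ)
  ... | yes dil = ⊥-elim (free dil)
  ... | no free′ = proj₂ (proj₂ (other-sheet ṽ free′))

  free-fibreV : ∀ {ṽ x} → ¬ DilV π (πV ṽ) → πV x ≡ πV ṽ → x ≡ ṽ ⊎ x ≡ ιV ṽ
  free-fibreV {ṽ} free over =
    FibreV.at-most-two-members (πV ṽ) NP.≤-refl refl (ιV-over ṽ) over (λ ṽ≡ιṽ → ιV-free ṽ free (sym ṽ≡ιṽ))

  ιV-involutive : ∀ ṽ → ιV (ιV ṽ) ≡ ṽ
  ιV-involutive ṽ = by-fibre (dilV? π (πV ṽ))
    where
    by-fibre : Dec (DilV π (πV ṽ)) → ιV (ιV ṽ) ≡ ṽ
    by-fibre (yes dil) = trans (cong ιV (ιV-dilated ṽ dil)) (ιV-dilated ṽ dil)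
    by-fibre (no free) with free-fibreV {ṽ} {ιV (ιV ṽ)} free (trans (ιV-over (ιV ṽ)) (ιV-over ṽ))
    ... | inj₁ ιιṽ≡ṽ  = ιιṽ≡ṽ
    ... | inj₂ ιιṽ≡ιṽ = ⊥-elim (ιV-free (ιV ṽ) (free ∘ subst (DilV π) (ιV-over ṽ)) ιιṽ≡ιṽ)

  -- Over a free vertex the two half-edges above a half-edge are exchanged, by harmonicity.
  end-ι : ∀ b ẽ → end {G̃} b (ι ẽ) ≡ ιV (end {G̃} b ẽ)
  end-ι b ẽ = by-fibre (dilV? π (πV x))
    where
    x = end {G̃} b ẽ
    same-image : πV x ≡ πV (end {G̃} b (ι ẽ))
    same-image = trans (sym (end-comm b ẽ)) (trans (cong (end {G} b) (sym (ι-over ẽ))) (end-comm b (ι ẽ)))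
    by-fibre : Dec (DilV π (πV x)) → end {G̃} b (ι ẽ) ≡ ιV x
    by-fibre (yes dil) = trans (dilV-unique dil (sym same-image) refl) (sym (ιV-dilated x dil))
    by-fibre (no free) with free-fibreV {x} {end {G̃} b (ι ẽ)} free (sym same-image)
    ... | inj₂ other = other
    ... | inj₁ same  = ⊥-elim (ι-free ẽ free-edge (lift-at-unique b x free (ι-over ẽ) same refl))
      where
      free-edge : ¬ DilE π (πE ẽ)
      free-edge dil = free (subst (DilV π) (end-comm b ẽ) (dilE-end b (πE ẽ) dil))

  ιV-≟ : ∀ a x → [ ιV a ≟' x ] ≡ [ a ≟' ιV x ]
  ιV-≟ a x with ιV a ≟ x | a ≟ ιV x
  ... | yes _ | yes _ = refl
  ... | no _  | no _  = refl
  ... | yes ιa≡x | no a≢ιx = ⊥-elim (a≢ιx (trans (sym (ιV-involutive a)) (cong ιV ιa≡x)))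
  ... | no ιa≢x | yes a≡ιx = ⊥-elim (ιa≢x (trans (cong ιV a≡ιx) (ιV-involutive x)))

  incidence-ι : ∀ ẽ x → incidence G̃ x (ι ẽ) ≡ incidence G̃ (ιV x) ẽ
  incidence-ι ẽ x = cong₂ (λ a b → ind a - ind b)
    (trans (cong (λ t → [ t ≟' x ]) (end-ι true ẽ)) (ιV-≟ (tgt G̃ ẽ) x))
    (trans (cong (λ t → [ t ≟' x ]) (end-ι false ẽ)) (ιV-≟ (src G̃ ẽ) x))

  ∂-ι* : ∀ z x → ∂ G̃ (ι* π ι z) x ≡ ∂ G̃ z (ιV x)
  ∂-ι* z x = begin
    ΣZ (λ ẽ → incidence G̃ x ẽ * z (ι ẽ))          ≡⟨ ΣZ-cong (λ ẽ → cong (λ t → incidence G̃ x t * z (ι ẽ)) (sym (ι-involutive ẽ))) ⟩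
    ΣZ (λ ẽ → incidence G̃ x (ι (ι ẽ)) * z (ι ẽ))  ≡⟨ ΣZ-reindex-involution ι ι-involutive (λ ẽ → incidence G̃ x (ι ẽ) * z ẽ) ⟩
    ΣZ (λ ẽ → incidence G̃ x (ι ẽ) * z ẽ)          ≡⟨ ΣZ-cong (λ ẽ → cong (_* z ẽ) (incidence-ι ẽ x)) ⟩
    ∂ G̃ z (ιV x)                                  ∎
    where open ≡-Reasoning

  ι*-cycle : ∀ z → IsCycle G̃ z → IsCycle G̃ (ι* π ι z)
  ι*-cycle z z-cycle x = trans (∂-ι* z x) (z-cycle (ιV x))

  π*-ι* : ∀ z → π* π (ι* π ι z) ≈[ G ] π* π z
  π*-ι* z e =
    trans (ΣZ-cong (λ ẽ → cong (λ a → if [ a ≟' e ] then z (ι ẽ) else + 0) (sym (ι-over ẽ))))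
          (ΣZ-reindex-involution ι ι-involutive (λ ẽ → if [ πE ẽ ≟' e ] then z ẽ else + 0))

  summand : Chain G̃ → Edg G → Edg G̃ → ℤ
  summand z e x = if [ πE x ≟' e ] then z x else + 0

  summand-over : ∀ z {e x} → πE x ≡ e → summand z e x ≡ z x
  summand-over z over rewrite [≟']-≡ over = refl

  -- Over a dilated edge both sheets coincide, whence the factor 2 in π^*.
  π^*-π* : ∀ z ẽ → π^* π (π* π z) ẽ ≡ z ẽ + z (ι ẽ)
  π^*-π* z ẽ with dilE? π (πE ẽ)
  ... | yes dil = begin
    + 2 * ΣZ (summand z (πE ẽ))        ≡⟨ cong (+ 2 *_) (trans (ΣZ-single _ ẽ others) (summand-over z refl)) ⟩
    + 2 * z ẽ                        ≡⟨ double (z ẽ) ⟩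
    z ẽ + z ẽ                        ≡⟨ cong (λ t → z ẽ + z t) (sym (ι-dilated ẽ dil)) ⟩
    z ẽ + z (ι ẽ)                    ∎
    where
    open ≡-Reasoning
    others : ∀ x → x ≢ ẽ → summand z (πE ẽ) x ≡ + 0
    others x x≢ẽ rewrite [≟']-≢ (x≢ẽ ∘ λ over → dilE-unique dil over refl) = refl
    double : ∀ a → + 2 * a ≡ a + a
    double = solve-∀
  ... | no free = trans (ZP.*-identityˡ _)
    (trans (ΣZ-pair _ ẽ (ι ẽ) (λ ẽ≡ιẽ → ι-free ẽ free (sym ẽ≡ιẽ)) others)
           (cong₂ _+_ (summand-over z refl) (summand-over z (ι-over ẽ))))
    where
    others : ∀ x → x ≢ ẽ → x ≢ ι ẽ → summand z (πE ẽ) x ≡ + 0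
    others x x≢ẽ x≢ιẽ with πE x ≟ πE ẽ
    ... | yes over = ⊥-elim ([ x≢ẽ , x≢ιẽ ]′ (free-fibreE free over))
    ... | no _     = refl

-- A spanning tree of G adapted to the dilation subgraph

module Components {G̃ G : Graph} (π : DoubleCover G̃ G) {d : ℕ} (nc : NumComponents π d) where

  component : Σ (Vtx G) (DilV π) → Fin d
  component = proj₁ nc

  component-surjective : ∀ k → ∃[ x ] component x ≡ k
  component-surjective = proj₁ (proj₂ nc)

  same-component⇒walk : ∀ x y → component x ≡ component y → DilWalk π (proj₁ x) (proj₁ y)
  same-component⇒walk x y = Equivalence.to (proj₂ (proj₂ nc) x y)

  walk⇒same-component : ∀ x y → DilWalk π (proj₁ x) (proj₁ y) → component x ≡ component y
  walk⇒same-component x y = Equivalence.from (proj₂ (proj₂ nc) x y)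

  edge-walk : ∀ b e → DilE π e → DilV π (end {G} b e) → DilWalk π (end {G} (not b) e) (end {G} b e)
  edge-walk true  e dil end-dil = fwd e dil (here end-dil)
  edge-walk false e dil end-dil = bwd e dil (here end-dil)

-- A rooted spanning tree of G in which, for every dilated vertex, climbing along dilated parent
-- edges ends at a vertex top v depending only on the component of v in the dilation subgraph.
record AdaptedTree {G̃ G : Graph} (π : DoubleCover G̃ G) {d : ℕ} (nc : NumComponents π d) (r : Vtx G) : Set where
  open Components π nc
  field
    par     : (v : Vtx G) → .(v ≢ r) → Edg G
    dir     : Vtx G → Bool
    depth   : Vtx G → ℕ
    par-end : ∀ v (v≢r : v ≢ r) → end {G} (dir v) (par v v≢r) ≡ v
    parent-shallower : ∀ v (v≢r : v ≢ r) → depth (end {G} (not (dir v)) (par v v≢r)) < depth v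
    top          : Vtx G → Vtx G
    top-root     : top r ≡ r
    top-free     : ∀ v (v≢r : v ≢ r) → ¬ DilE π (par v v≢r) → top v ≡ v
    top-dilated  : ∀ v (v≢r : v ≢ r) → DilE π (par v v≢r) → top v ≡ top (end {G} (not (dir v)) (par v v≢r))
    top-component : ∀ x y → component x ≡ component y → top (proj₁ x) ≡ top (proj₁ y)

  tree : RootedTree G
  tree = record { root = r ; par = par ; dir = dir ; depth = depth ; par-end = par-end
                ; parent-shallower = parent-shallower }

edgeless-adapted-tree : ∀ {G̃ G : Graph} (π : DoubleCover G̃ G) → Connected G → ∀ {d} (nc : NumComponents π d) (r : Vtx G) →
  nE G ≡ 0 → AdaptedTree π nc r
edgeless-adapted-tree {G = G} π connected nc r no-edges = record
  { par = λ v v≢r → IR.⊥-elim (v≢r (only-r v))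
  ; dir = λ _ → true
  ; depth = λ _ → 0
  ; par-end = λ v v≢r → ⊥-elim (v≢r (only-r v))
  ; parent-shallower = λ v v≢r → ⊥-elim (v≢r (only-r v))
  ; top = id
  ; top-root = refl
  ; top-free = λ _ _ _ → refl
  ; top-dilated = λ v v≢r → ⊥-elim (v≢r (only-r v))
  ; top-component = λ x y _ → trans (only-r _) (sym (only-r _))
  }
  where
  no-edge : Edg G → ⊥
  no-edge e with () ← subst Fin no-edges e
  walk-trivial : ∀ {u v} → Walk G u v → u ≡ v
  walk-trivial here      = refl
  walk-trivial (fwd e _) = ⊥-elim (no-edge e)
  walk-trivial (bwd e _) = ⊥-elim (no-edge e)
  only-r : ∀ v → v ≡ r
  only-r v = sym (walk-trivial (connected r v))

update : ∀ {n} {A : Set} → (Fin n → A) → Fin n → A → Fin n → A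
update f x a v = if [ v ≟' x ] then a else f v

update-at : ∀ {n} {A : Set} (f : Fin n → A) x a → update f x a x ≡ a
update-at f x a rewrite [≟']-refl x = refl

update-away : ∀ {n} {A : Set} (f : Fin n → A) x a {v} → v ≢ x → update f x a v ≡ f v
update-away f x a v≢x rewrite [≟']-≢ v≢x = refl

-- Grow a tree from r one edge at a time, preferring dilated edges leaving the reached set: then a
-- component of the dilation subgraph is entered once and completed by dilated edges before any
-- other edge is used, so all of it climbs to the vertex through which it was entered.
module Growth {G̃ G : Graph} (π : DoubleCover G̃ G) (connected : Connected G) {d : ℕ} (nc : NumComponents π d)
              (r : Vtx G) (e₀ : Edg G) where
  open CoverFibres π
  open Components π nc

  dil : Edg G → Bool
  dil e = does (dilE? π e)

  record Partial : Set where
    field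
      reached : Vtx G → Bool
      parS    : Vtx G → Edg G
      dirS    : Vtx G → Bool
      depthS  : Vtx G → ℕ
      topS    : Vtx G → Vtx G

  module _ (P : Partial) where
    open Partial P

    parentS : Vtx G → Vtx G
    parentS v = end {G} (not (dirS v)) (parS v)

    stopS : Vtx G → Bool
    stopS v = [ v ≟' r ] ∨ not (dil (parS v))

    record Invariant : Set where
      field
        root-reached : reached r ≡ true
        par-end      : ∀ v → reached v ≡ true → v ≢ r → end {G} (dirS v) (parS v) ≡ v
        parent-reached : ∀ v → reached v ≡ true → v ≢ r → reached (parentS v) ≡ true
        parent-shallower : ∀ v → reached v ≡ true → v ≢ r → depthS (parentS v) < depthS v
        top-stop     : ∀ v → reached v ≡ true → stopS v ≡ true → topS v ≡ v
        top-step     : ∀ v → reached v ≡ true → stopS v ≡ false → topS v ≡ topS (parentS v)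
        top-component : ∀ (x y : Σ (Vtx G) (DilV π)) → reached (proj₁ x) ≡ true → reached (proj₁ y) ≡ true →
                        component x ≡ component y → topS (proj₁ x) ≡ topS (proj₁ y)

    Leaving : Edg G → Bool → Set
    Leaving e b = reached (end {G} b e) ≡ false × reached (end {G} (not b) e) ≡ true

    leaving? : ∀ e b → Dec (Leaving e b)
    leaving? e b with reached (end {G} b e) | reached (end {G} (not b) e)
    ... | false | true  = yes (refl , refl)
    ... | true  | _     = no (λ (out , _) → true≢false out)
    ... | false | false = no (λ (_ , in′) → true≢false (sym in′))

    LeavingEdge : Edg G → Set
    LeavingEdge e = Σ Bool (Leaving e)

    leavingEdge? : ∀ e → Dec (LeavingEdge e)
    leavingEdge? e with leaving? e true | leaving? e false
    ... | yes l | _     = yes (true , l)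
    ... | no _  | yes l = yes (false , l)
    ... | no ¬t | no ¬f = no λ { (true , l) → ¬t l ; (false , l) → ¬f l }

    SomeLeaving DilatedLeaving : Set
    SomeLeaving = ∃[ e ] LeavingEdge e
    DilatedLeaving = ∃[ e ] (DilE π e × LeavingEdge e)

    someLeaving? : Dec SomeLeaving
    someLeaving? = FP.any? leavingEdge?

    dilatedLeaving? : Dec DilatedLeaving
    dilatedLeaving? = FP.any? (λ e → dilE? π e ×-dec leavingEdge? e)

    closed-under-walks : ¬ SomeLeaving → ∀ {u v} → Walk G u v → reached u ≡ true → reached v ≡ true
    closed-under-walks closed here          u-in = u-in
    closed-under-walks closed (fwd e walk) u-in with reached (tgt G e) in eq
    ... | true  = closed-under-walks closed walk eq
    ... | false = ⊥-elim (closed (e , true , eq , u-in))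
    closed-under-walks closed (bwd e walk) u-in with reached (src G e) in eq
    ... | true  = closed-under-walks closed walk eq
    ... | false = ⊥-elim (closed (e , false , eq , u-in))

    dilated-walk-leaves : ∀ {u v} → DilWalk π u v → reached u ≡ true → reached v ≡ false → DilatedLeaving
    dilated-walk-leaves (here _) u-in v-out = ⊥-elim (true≢false (trans (sym u-in) v-out))
    dilated-walk-leaves (fwd e dil walk) u-in v-out with reached (tgt G e) in eq
    ... | true  = dilated-walk-leaves walk eq v-out
    ... | false = e , dil , true , eq , u-in
    dilated-walk-leaves (bwd e dil walk) u-in v-out with reached (src G e) in eq
    ... | true  = dilated-walk-leaves walk eq v-out
    ... | false = e , dil , false , eq , u-in

  attach : Partial → Edg G → Bool → Partial
  attach P e b = record
    { reached = λ v → reached v ∨ [ v ≟' x ]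
    ; parS    = update parS x e
    ; dirS    = update dirS x b
    ; depthS  = update depthS x (suc (depthS y))
    ; topS    = update topS x (if dil e then topS y else x)
    }
    where
    open Partial P
    x = end {G} b e
    y = end {G} (not b) e

  moving⇒≢r : ∀ P v → stopS P v ≡ false → v ≢ r
  moving⇒≢r P v moving refl rewrite [≟']-refl r = true≢false moving

  module Attach (P : Partial) (inv : Invariant P) (e : Edg G) (b : Bool) (leaving : Leaving P e b)
                (prefer-dilated : ¬ DilE π e → ¬ DilatedLeaving P) where
    open Partial P
    open Invariant inv
    x = end {G} b e
    y = end {G} (not b) e
    P′ = attach P e b
    module P′ = Partial P′
    x-top = if dil e then topS y else x

    x-out : reached x ≡ false
    x-out = proj₁ leaving

    y-in : reached y ≡ true
    y-in = proj₂ leaving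

    reached⇒≢x : ∀ {v} → reached v ≡ true → v ≢ x
    reached⇒≢x v-in refl = true≢false (trans (sym v-in) x-out)

    x≢r : x ≢ r
    x≢r x≡r = reached⇒≢x root-reached (sym x≡r)

    reached′ : ∀ v → P′.reached v ≡ true → (reached v ≡ true × v ≢ x) ⊎ v ≡ x
    reached′ v v-in with v ≟ x
    ... | yes v≡x = inj₂ v≡x
    ... | no v≢x  = inj₁ (trans (sym (BP.∨-identityʳ (reached v))) v-in , v≢x)

    still-reached : ∀ v → reached v ≡ true → P′.reached v ≡ true
    still-reached v v-in rewrite v-in = refl

    parent-old : ∀ v → v ≢ x → parentS P′ v ≡ parentS P v
    parent-old v v≢x rewrite update-away dirS x b v≢x | update-away parS x e v≢x = refl

    stop-old : ∀ v → v ≢ x → stopS P′ v ≡ stopS P v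
    stop-old v v≢x rewrite update-away parS x e v≢x = refl

    parent-x : parentS P′ x ≡ y
    parent-x rewrite update-at dirS x b | update-at parS x e = refl

    stop-x : stopS P′ x ≡ not (dil e)
    stop-x rewrite update-at parS x e | [≟']-≢ x≢r = refl

    top-x-dilated : DilE π e → P′.topS x ≡ topS y
    top-x-dilated dil-e rewrite update-at topS x x-top | dec-true (dilE? π e) dil-e = refl

    top-x-free : ¬ DilE π e → P′.topS x ≡ x
    top-x-free free rewrite update-at topS x x-top | dec-false (dilE? π e) free = refl

    -- A dilated x in the component of a reached w was entered by a dilated edge from y.
    top-x-component : ∀ (x-dil : DilV π x) (w : Σ (Vtx G) (DilV π)) → reached (proj₁ w) ≡ true →
      component (x , x-dil) ≡ component w → P′.topS x ≡ P′.topS (proj₁ w)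
    top-x-component x-dil (w , w-dil) w-in same = by-edge (dilE? π e)
      where
      by-edge : Dec (DilE π e) → P′.topS x ≡ P′.topS w
      by-edge (yes dil-e) = trans (top-x-dilated dil-e) (trans
        (top-component (y , dilE-end (not b) e dil-e) (w , w-dil) y-in w-in
          (trans (walk⇒same-component (y , _) (x , x-dil) (edge-walk b e dil-e x-dil)) same))
        (sym (update-away topS x x-top (reached⇒≢x w-in))))
      by-edge (no free) =
        ⊥-elim (prefer-dilated free (dilated-walk-leaves P (same-component⇒walk (w , w-dil) (x , x-dil) (sym same)) w-in x-out))

    par-end′ : ∀ v → P′.reached v ≡ true → v ≢ r → end {G} (P′.dirS v) (P′.parS v) ≡ v
    par-end′ v v-in v≢r with reached′ v v-in
    ... | inj₁ (old , v≢x) rewrite update-away dirS x b v≢x | update-away parS x e v≢x = par-end v old v≢r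
    ... | inj₂ refl rewrite update-at dirS x b | update-at parS x e = refl

    parent-reached′ : ∀ v → P′.reached v ≡ true → v ≢ r → P′.reached (parentS P′ v) ≡ true
    parent-reached′ v v-in v≢r with reached′ v v-in
    ... | inj₁ (old , v≢x) rewrite parent-old v v≢x = still-reached _ (parent-reached v old v≢r)
    ... | inj₂ refl rewrite parent-x = still-reached y y-in

    parent-shallower′ : ∀ v → P′.reached v ≡ true → v ≢ r → P′.depthS (parentS P′ v) < P′.depthS v
    parent-shallower′ v v-in v≢r with reached′ v v-in
    ... | inj₁ (old , v≢x) rewrite parent-old v v≢x | update-away depthS x (suc (depthS y)) v≢x
      | update-away depthS x (suc (depthS y)) (reached⇒≢x (parent-reached v old v≢r)) = parent-shallower v old v≢r
    ... | inj₂ refl rewrite parent-x | update-at depthS x (suc (depthS y))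
      | update-away depthS x (suc (depthS y)) (reached⇒≢x y-in) = NP.n<1+n _

    top-stop′ : ∀ v → P′.reached v ≡ true → stopS P′ v ≡ true → P′.topS v ≡ v
    top-stop′ v v-in stops with reached′ v v-in
    ... | inj₁ (old , v≢x) rewrite update-away topS x x-top v≢x = top-stop v old (trans (sym (stop-old v v≢x)) stops)
    ... | inj₂ refl = top-x-free (λ dil-e → true≢false (trans (sym stops) (trans stop-x (cong not (dec-true (dilE? π e) dil-e)))))

    top-step′ : ∀ v → P′.reached v ≡ true → stopS P′ v ≡ false → P′.topS v ≡ P′.topS (parentS P′ v)
    top-step′ v v-in moving with reached′ v v-in
    ... | inj₁ (old , v≢x) rewrite parent-old v v≢x | update-away topS x x-top v≢x
      | update-away topS x x-top (reached⇒≢x (parent-reached v old (moving⇒≢r P v (trans (sym (stop-old v v≢x)) moving)))) =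
        top-step v old (trans (sym (stop-old v v≢x)) moving)
    ... | inj₂ refl rewrite parent-x =
        trans (top-x-dilated (does-true (dilE? π e) (not-false (trans (sym stop-x) moving))))
              (sym (update-away topS x x-top (reached⇒≢x y-in)))

    top-component′ : ∀ (u w : Σ (Vtx G) (DilV π)) → P′.reached (proj₁ u) ≡ true → P′.reached (proj₁ w) ≡ true →
      component u ≡ component w → P′.topS (proj₁ u) ≡ P′.topS (proj₁ w)
    top-component′ (u , u-dil) (w , w-dil) u-in w-in same with reached′ u u-in | reached′ w w-in
    ... | inj₂ refl | inj₂ refl = refl
    ... | inj₂ refl | inj₁ (w-old , _) = top-x-component u-dil (w , w-dil) w-old same
    ... | inj₁ (u-old , _) | inj₂ refl = sym (top-x-component w-dil (u , u-dil) u-old (sym same))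
    ... | inj₁ (u-old , u≢x) | inj₁ (w-old , w≢x) rewrite update-away topS x x-top u≢x | update-away topS x x-top w≢x =
        top-component (u , u-dil) (w , w-dil) u-old w-old same

    invariant : Invariant P′
    invariant = record
      { root-reached = still-reached r root-reached
      ; par-end = par-end′
      ; parent-reached = parent-reached′
      ; parent-shallower = parent-shallower′
      ; top-stop = top-stop′
      ; top-step = top-step′
      ; top-component = top-component′
      }

    grows : count P′.reached ≡ suc (count reached)
    grows = count-insert reached x x-out

  start : Partial
  start = record { reached = λ v → [ v ≟' r ] ; parS = λ _ → e₀ ; dirS = λ _ → true ; depthS = λ _ → 0 ; topS = id }

  start-invariant : Invariant start
  start-invariant = record
    { root-reached = [≟']-refl r
    ; par-end = λ v v≡r v≢r → ⊥-elim (v≢r ([≟']-true v≡r))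
    ; parent-reached = λ v v≡r v≢r → ⊥-elim (v≢r ([≟']-true v≡r))
    ; parent-shallower = λ v v≡r v≢r → ⊥-elim (v≢r ([≟']-true v≡r))
    ; top-stop = λ _ _ _ → refl
    ; top-step = λ v v≡r moving → ⊥-elim (moving⇒≢r start v moving ([≟']-true v≡r))
    ; top-component = λ x y x≡r y≡r _ → trans ([≟']-true x≡r) (sym ([≟']-true y≡r))
    }

  step-with : (P : Partial) → Dec (DilatedLeaving P) → Dec (SomeLeaving P) → Partial
  step-with P (yes (e , _ , b , _)) _                 = attach P e b
  step-with P (no _)                (yes (e , b , _)) = attach P e b
  step-with P (no _)                (no _)            = P

  step : Partial → Partial
  step P = step-with P (dilatedLeaving? P) (someLeaving? P)

  step-invariant : ∀ P → Invariant P → ∀ dl? sl? → Invariant (step-with P dl? sl?)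
  step-invariant P inv (yes (e , dil-e , b , l)) _ = Attach.invariant P inv e b l (λ free _ → free dil-e)
  step-invariant P inv (no none) (yes (e , b , l)) = Attach.invariant P inv e b l (λ _ → none)
  step-invariant P inv (no _) (no _) = inv

  Progress : ℕ → Partial → Set
  Progress k P = ¬ SomeLeaving P ⊎ k ≤ count (Partial.reached P)

  step-progress : ∀ P inv k → Progress k P → ∀ dl? sl? → Progress (suc k) (step-with P dl? sl?)
  step-progress P inv k progress (yes (e , dil-e , b , l)) _ =
    inj₂ (grown (Attach.grows P inv e b l (λ free _ → free dil-e)) progress)
    where
    grown : ∀ {n} → n ≡ suc (count (Partial.reached P)) → Progress k P → suc k ≤ n
    grown eq (inj₁ closed) = ⊥-elim (closed (e , b , l))
    grown eq (inj₂ k≤)     = subst (suc k ≤_) (sym eq) (s≤s k≤)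
  step-progress P inv k progress (no none) (yes (e , b , l)) =
    inj₂ (grown (Attach.grows P inv e b l (λ _ → none)) progress)
    where
    grown : ∀ {n} → n ≡ suc (count (Partial.reached P)) → Progress k P → suc k ≤ n
    grown eq (inj₁ closed) = ⊥-elim (closed (e , b , l))
    grown eq (inj₂ k≤)     = subst (suc k ≤_) (sym eq) (s≤s k≤)
  step-progress P inv k progress (no _) (no closed) = inj₁ closed

  run : ℕ → Partial
  run zero    = start
  run (suc k) = step (run k)

  run-invariant : ∀ k → Invariant (run k)
  run-invariant zero    = start-invariant
  run-invariant (suc k) = step-invariant (run k) (run-invariant k) (dilatedLeaving? (run k)) (someLeaving? (run k))

  run-progress : ∀ k → Progress (suc k) (run k)
  run-progress zero    = inj₂ (NP.≤-reflexive (sym (count-singleton r)))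
  run-progress (suc k) =
    step-progress (run k) (run-invariant k) (suc k) (run-progress k) (dilatedLeaving? (run k)) (someLeaving? (run k))

  final : Partial
  final = run (nV G)

  module F = Partial final
  module FI = Invariant (run-invariant (nV G))

  -- After nV G steps at least nV G + 1 vertices would be reached, so the growth has stopped.
  final-closed : ¬ SomeLeaving final
  final-closed with run-progress (nV G)
  ... | inj₁ closed = closed
  ... | inj₂ too-many = ⊥-elim (NP.<⇒≱ (s≤s (count≤size F.reached)) too-many)

  all-reached : ∀ v → F.reached v ≡ true
  all-reached v = closed-under-walks final final-closed (connected r v) FI.root-reached

  adapted-tree : AdaptedTree π nc r
  adapted-tree = record
    { par = λ v _ → F.parS v
    ; dir = F.dirS
    ; depth = F.depthS
    ; par-end = λ v v≢r → FI.par-end v (all-reached v) v≢r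
    ; parent-shallower = λ v v≢r → FI.parent-shallower v (all-reached v) v≢r
    ; top = F.topS
    ; top-root = FI.top-stop r (all-reached r) (cong (_∨ not (dil (F.parS r))) ([≟']-refl r))
    ; top-free = λ v v≢r free → FI.top-stop v (all-reached v) (stops v v≢r free)
    ; top-dilated = λ v v≢r dil → FI.top-step v (all-reached v) (moves v v≢r dil)
    ; top-component = λ x y same → FI.top-component x y (all-reached _) (all-reached _) same
    }
    where
    stops : ∀ v → v ≢ r → ¬ DilE π (F.parS v) → stopS final v ≡ true
    stops v v≢r free rewrite [≟']-≢ v≢r | dec-false (dilE? π (F.parS v)) free = refl
    moves : ∀ v → v ≢ r → DilE π (F.parS v) → stopS final v ≡ false
    moves v v≢r dil rewrite [≟']-≢ v≢r | dec-true (dilE? π (F.parS v)) dil = refl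

adapted-tree : ∀ {G̃ G : Graph} (π : DoubleCover G̃ G) → Connected G → ∀ {d} (nc : NumComponents π d) (r : Vtx G) →
  AdaptedTree π nc r
adapted-tree {G = G} π connected nc r with nE G in eq
... | zero  = edgeless-adapted-tree π connected nc r eq
... | suc _ = Growth.adapted-tree π connected nc r (subst Fin (sym eq) zero)

module LiftedTree {G̃ G : Graph} (π : DoubleCover G̃ G) (T : RootedTree G) (root-dilated : DilV π (RootedTree.root T)) where
  open DoubleCover π
  open CoverFibres π
  open RootedTree T
  open Tree T using (parent)

  r̃ : Vtx G̃
  r̃ = proj₁ (lift-vertex root)

  r̃-over : πV r̃ ≡ root
  r̃-over = proj₂ (lift-vertex root)

  over-root : ∀ {ṽ} → πV ṽ ≡ root → ṽ ≡ r̃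
  over-root over = dilV-unique root-dilated over r̃-over

  ≢r̃ : ∀ {ṽ} → ṽ ≢ r̃ → πV ṽ ≢ root
  ≢r̃ ṽ≢r̃ = ṽ≢r̃ ∘ over-root

  -- The parent edge of ṽ is the lift at ṽ, given by harmonicity, of the parent edge of πV ṽ.
  par-lift : (ṽ : Vtx G̃) (v≢root : πV ṽ ≢ root) → ∃[ ẽ ] (πE ẽ ≡ par (πV ṽ) v≢root × end {G̃} (dir (πV ṽ)) ẽ ≡ ṽ)
  par-lift ṽ v≢root = lift-at (dir (πV ṽ)) ṽ (par (πV ṽ) v≢root) (par-end (πV ṽ) v≢root)

  par̃-from : (ṽ : Vtx G̃) → Dec (πV ṽ ≡ root) → .(ṽ ≢ r̃) → Edg G̃
  par̃-from ṽ (yes over) ṽ≢r̃ = IR.⊥-elim (ṽ≢r̃ (over-root over))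
  par̃-from ṽ (no v≢root) _  = proj₁ (par-lift ṽ v≢root)

  par̃ : (ṽ : Vtx G̃) → .(ṽ ≢ r̃) → Edg G̃
  par̃ ṽ = par̃-from ṽ (πV ṽ ≟ root)

  par̃-over : ∀ ṽ (ṽ≢r̃ : ṽ ≢ r̃) (v≢root : πV ṽ ≢ root) → πE (par̃ ṽ ṽ≢r̃) ≡ par (πV ṽ) v≢root
  par̃-over ṽ ṽ≢r̃ v≢root = by-root (πV ṽ ≟ root)
    where
    by-root : (dec : Dec (πV ṽ ≡ root)) → πE (par̃-from ṽ dec ṽ≢r̃) ≡ par (πV ṽ) v≢root
    by-root (yes over) = ⊥-elim (v≢root over)
    by-root (no v≢root′) = proj₁ (proj₂ (par-lift ṽ v≢root′))

  par̃-end : ∀ ṽ (ṽ≢r̃ : ṽ ≢ r̃) → end {G̃} (dir (πV ṽ)) (par̃ ṽ ṽ≢r̃) ≡ ṽ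
  par̃-end ṽ ṽ≢r̃ = by-root (πV ṽ ≟ root)
    where
    by-root : (dec : Dec (πV ṽ ≡ root)) → end {G̃} (dir (πV ṽ)) (par̃-from ṽ dec ṽ≢r̃) ≡ ṽ
    by-root (yes over) = ⊥-elim (ṽ≢r̃ (over-root over))
    by-root (no v≢root) = proj₂ (proj₂ (par-lift ṽ v≢root))

  parent̃-over : ∀ ṽ (ṽ≢r̃ : ṽ ≢ r̃) (v≢root : πV ṽ ≢ root) →
    πV (end {G̃} (not (dir (πV ṽ))) (par̃ ṽ ṽ≢r̃)) ≡ parent (πV ṽ) v≢root
  parent̃-over ṽ ṽ≢r̃ v≢root =
    trans (sym (end-comm (not (dir (πV ṽ))) (par̃ ṽ ṽ≢r̃))) (cong (end {G} (not (dir (πV ṽ)))) (par̃-over ṽ ṽ≢r̃ v≢root))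

  T̃ : RootedTree G̃
  T̃ = record
    { root = r̃ ; par = par̃ ; dir = dir ∘ πV ; depth = depth ∘ πV
    ; par-end = par̃-end
    ; parent-shallower = λ ṽ ṽ≢r̃ → subst (λ x → depth x < depth (πV ṽ)) (sym (parent̃-over ṽ ṽ≢r̃ (≢r̃ ṽ≢r̃)))
                                          (parent-shallower (πV ṽ) (≢r̃ ṽ≢r̃)) }

  module Projected (stop : Vtx G → Bool) (stop-root : stop root ≡ true) =
    PushClimb T̃ T πV πE stop stop-root (trans (cong stop r̃-over) stop-root) (λ _ → refl)
      (λ ṽ ṽ≢r̃ v≢root → par̃-over ṽ ṽ≢r̃ v≢root) (λ ṽ ṽ≢r̃ v≢root → parent̃-over ṽ ṽ≢r̃ v≢root)

-- Fundamental cycles of a system of paths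

-- With P v a chain from v to top v, an edge whose ends have the same top closes a cycle.
fundamental : ∀ {H : Graph} → (Vtx H → Chain H) → Edg H → Chain H
fundamental {H} P e x = δ e x - P (tgt H e) x + P (src H e) x

fundamental-cycle : ∀ {H : Graph} (P : Vtx H → Chain H) (top : Vtx H → Vtx H) →
  (∀ v u → ∂ H (P v) u ≡ δ v u - δ (top v) u) → ∀ e → top (tgt H e) ≡ top (src H e) →
  IsCycle H (fundamental {H} P e)
fundamental-cycle {H} P top ∂P e same-top u = begin
  ∂ H (fundamental {H} P e) u
    ≡⟨ ∂-distrib-+ H _ _ u ⟩
  ∂ H (λ x → δ e x - P (tgt H e) x) u + ∂ H (P (src H e)) u
    ≡⟨ cong₂ _+_ (trans (∂-distrib-- H _ _ u) (cong₂ _-_ (∂-edge H e u) (∂P (tgt H e) u))) (∂P (src H e) u) ⟩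
  (δ t u - δ s u) - (δ t u - δ (top t) u) + (δ s u - δ (top s) u)
    ≡⟨ cong (λ x → (δ t u - δ s u) - (δ t u - δ x u) + (δ s u - δ (top s) u)) same-top ⟩
  (δ t u - δ s u) - (δ t u - δ (top s) u) + (δ s u - δ (top s) u)
    ≡⟨ cancel (δ t u) (δ s u) (δ (top s) u) ⟩
  + 0 ∎
  where
  open ≡-Reasoning
  t = tgt H e
  s = src H e
  cancel : ∀ a b c → (a - b) - (a - c) + (b - c) ≡ + 0
  cancel = solve-∀

fundamental-off-paths : ∀ {H : Graph} (P : Vtx H → Chain H) e x → (∀ v → P v x ≡ + 0) → fundamental {H} P e x ≡ δ e x
fundamental-off-paths {H} P e x off = trans (cong₂ (λ a b → δ e x - a + b) (off (tgt H e)) (off (src H e))) (drop-zeros (δ e x))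
  where
  drop-zeros : ∀ y → y - + 0 + + 0 ≡ y
  drop-zeros = solve-∀

push-fundamental : ∀ {H′ H : Graph} (pV : Vtx H′ → Vtx H) (pE : Edg H′ → Edg H) →
  (∀ ẽ → tgt H (pE ẽ) ≡ pV (tgt H′ ẽ)) → (∀ ẽ → src H (pE ẽ) ≡ pV (src H′ ẽ)) →
  (P′ : Vtx H′ → Chain H′) (P : Vtx H → Chain H) → (∀ ṽ → push pE (P′ ṽ) ≈[ H ] P (pV ṽ)) →
  ∀ ẽ → push pE (fundamental {H′} P′ ẽ) ≈[ H ] fundamental {H} P (pE ẽ)
push-fundamental {H′} {H} pV pE tgt-comm src-comm P′ P push-P ẽ e = begin
  push pE (fundamental {H′} P′ ẽ) e
    ≡⟨ push-distrib-+ pE _ _ e ⟩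
  push pE (λ x → δ ẽ x - P′ (tgt H′ ẽ) x) e + push pE (P′ (src H′ ẽ)) e
    ≡⟨ cong (_+ push pE (P′ (src H′ ẽ)) e) (push-distrib-- pE _ _ e) ⟩
  push pE (δ ẽ) e - push pE (P′ (tgt H′ ẽ)) e + push pE (P′ (src H′ ẽ)) e
    ≡⟨ cong₂ _+_ (cong₂ _-_ (push-edge pE ẽ e) (trans (push-P (tgt H′ ẽ) e) (cong (λ v → P v e) (sym (tgt-comm ẽ)))))
                 (trans (push-P (src H′ ẽ) e) (cong (λ v → P v e) (sym (src-comm ẽ)))) ⟩
  fundamental {H} P (pE ẽ) e ∎
  where open ≡-Reasoning

⊕-left : ∀ {p q} {X : Set} (f : Fin p → X) (g : Fin q → X) x → (f ⊕ g) (x ↑ˡ q) ≡ f x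
⊕-left {p} {q} f g x rewrite FP.splitAt-↑ˡ p x q = refl

⊕-right : ∀ {p q} {X : Set} (f : Fin p → X) (g : Fin q → X) y → (f ⊕ g) (p ↑ʳ y) ≡ g y
⊕-right {p} {q} f g y rewrite FP.splitAt-↑ʳ p q y = refl

data Side (p q : ℕ) : Fin (p ℕ.+ q) → Set where
  left  : ∀ x → Side p q (x ↑ˡ q)
  right : ∀ y → Side p q (p ↑ʳ y)

side : ∀ p q (k : Fin (p ℕ.+ q)) → Side p q k
side p q k with splitAt p k in eq
... | inj₁ x = subst (Side p q) (FP.splitAt⁻¹-↑ˡ eq) (left x)
... | inj₂ y = subst (Side p q) (FP.splitAt⁻¹-↑ʳ eq) (right y)

↑ˡ≢↑ʳ : ∀ {p q} (x : Fin p) (y : Fin q) → x ↑ˡ q ≢ p ↑ʳ y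
↑ˡ≢↑ʳ {p} {q} x y eq with () ← trans (sym (FP.splitAt-↑ˡ p x q)) (trans (cong (splitAt p) eq) (FP.splitAt-↑ʳ p q y))

⊕-all : ∀ {p q} {X : Set} (Q : X → Set) (f : Fin p → X) (g : Fin q → X) →
  (∀ i → Q (f i)) → (∀ i → Q (g i)) → ∀ i → Q ((f ⊕ g) i)
⊕-all {p} {q} Q f g Qf Qg i with side p q i
... | left x  rewrite ⊕-left f g x  = Qf x
... | right y rewrite ⊕-right f g y = Qg y

⊕-all-left : ∀ {p q} {X : Set} (Q : X → Set) (f : Fin p → X) (g : Fin q → X) →
  (∀ i → Q ((f ⊕ g) i)) → ∀ i → Q (f i)
⊕-all-left {p} {q} Q f g Q⊕ i = subst Q (⊕-left f g i) (Q⊕ (i ↑ˡ q))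

⊕-all-right : ∀ {p q} {X : Set} (Q : X → Set) (f : Fin p → X) (g : Fin q → X) →
  (∀ i → Q ((f ⊕ g) i)) → ∀ i → Q (g i)
⊕-all-right {p} {q} Q f g Q⊕ i = subst Q (⊕-right f g i) (Q⊕ (p ↑ʳ i))

⊕-dual : ∀ {n p q} (b₁ w₁ : Fin p → Fin n → ℤ) (b₂ w₂ : Fin q → Fin n → ℤ) →
  (∀ j i → ⟨ w₁ j , b₁ i ⟩ ≡ δ j i) → (∀ j i → ⟨ w₁ j , b₂ i ⟩ ≡ + 0) →
  (∀ j i → ⟨ w₂ j , b₁ i ⟩ ≡ + 0) → (∀ j i → ⟨ w₂ j , b₂ i ⟩ ≡ δ j i) →
  ∀ j i → ⟨ (w₁ ⊕ w₂) j , (b₁ ⊕ b₂) i ⟩ ≡ δ j i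
⊕-dual {p = p} {q} b₁ w₁ b₂ w₂ d₁₁ d₁₂ d₂₁ d₂₂ j i with side p q j | side p q i
... | left x  | left y  rewrite ⊕-left w₁ w₂ x  | ⊕-left b₁ b₂ y  = trans (d₁₁ x y) (sym (δ-injective (_↑ˡ q) (FP.↑ˡ-injective q _ _) x y))
... | left x  | right y rewrite ⊕-left w₁ w₂ x  | ⊕-right b₁ b₂ y = trans (d₁₂ x y) (sym (δ-≢ (↑ˡ≢↑ʳ x y)))
... | right x | left y  rewrite ⊕-right w₁ w₂ x | ⊕-left b₁ b₂ y  = trans (d₂₁ x y) (sym (δ-≢ (↑ˡ≢↑ʳ y x ∘ sym)))
... | right x | right y rewrite ⊕-right w₁ w₂ x | ⊕-right b₁ b₂ y = trans (d₂₂ x y) (sym (δ-injective (p ↑ʳ_) (FP.↑ʳ-injective p _ _) x y))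

-- The adapted bases

module Construction {G̃ G : Graph} (π : DoubleCover G̃ G) (ι : Edg G̃ → Edg G̃) (ι-sheet : IsSheetInvolution π ι)
  {d : ℕ} (nc : NumComponents π d) (r : Vtx G) (r-dil : DilV π r) (adapted : AdaptedTree π nc r) where
  open DoubleCover π
  open CoverFibres π
  open SheetInvolution π ι ι-sheet
  open Components π nc
  open AdaptedTree adapted
  open LiftedTree π tree r-dil
  module TG = Tree tree
  module TG̃ = Tree T̃
  open TG using (parent; IsTreeEdge; treeEdge?)

  K : ℕ
  K = TG.depth-bound

  depth<K : ∀ v → depth v < K
  depth<K = TG.depth<bound

  at-root : Vtx G → Bool
  at-root v = [ v ≟' r ]

  at-top-from : (v : Vtx G) → Dec (v ≡ r) → Bool
  at-top-from v (yes _)  = true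
  at-top-from v (no v≢r) = not (does (dilE? π (par v v≢r)))

  at-top : Vtx G → Bool
  at-top v = at-top-from v (v ≟ r)

  at-top-r : at-top r ≡ true
  at-top-r = by-root (r ≟ r)
    where
    by-root : (dec : Dec (r ≡ r)) → at-top-from r dec ≡ true
    by-root (yes _)  = refl
    by-root (no r≢r) = ⊥-elim (r≢r refl)

  at-top-≢r : ∀ v (v≢r : v ≢ r) → at-top v ≡ not (does (dilE? π (par v v≢r)))
  at-top-≢r v v≢r = by-root (v ≟ r)
    where
    by-root : (dec : Dec (v ≡ r)) → at-top-from v dec ≡ not (does (dilE? π (par v v≢r)))
    by-root (yes v≡r) = ⊥-elim (v≢r v≡r)
    by-root (no _)    = refl

  moving⇒dilated : ∀ v (v≢r : v ≢ r) → at-top v ≡ false → DilE π (par v v≢r)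
  moving⇒dilated v v≢r moving = does-true (dilE? π (par v v≢r)) (not-false (trans (sym (at-top-≢r v v≢r)) moving))

  stopping⇒free : ∀ v (v≢r : v ≢ r) → at-top v ≡ true → ¬ DilE π (par v v≢r)
  stopping⇒free v v≢r stops = does-false (dilE? π (par v v≢r)) (not-true (trans (sym (at-top-≢r v v≢r)) stops))

  dilated⇒moving : ∀ v (v≢r : v ≢ r) → DilE π (par v v≢r) → at-top v ≡ false
  dilated⇒moving v v≢r dil = trans (at-top-≢r v v≢r) (cong not (dec-true (dilE? π (par v v≢r)) dil))

  module ToRoot = Projected at-root ([≟']-refl r)
  module ToTop  = Projected at-top at-top-r

  rootPath topPath : Vtx G → Chain G
  rootPath = ToRoot.Target.climb K
  topPath  = ToTop.Target.climb K

  rootPath̃ topPath̃ : Vtx G̃ → Chain G̃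
  rootPath̃ = ToRoot.Source.climb K
  topPath̃  = ToTop.Source.climb K

  ∂-rootPath : ∀ v u → ∂ G (rootPath v) u ≡ δ v u - δ r u
  ∂-rootPath v u = trans (ToRoot.Target.∂-climb K v (depth<K v) u)
    (cong (λ t → δ v u - δ t u) ([≟']-true {x = ToRoot.Target.summit K v} {r} (ToRoot.Target.summit-stops K v (depth<K v))))

  ∂-rootPath̃ : ∀ ṽ u → ∂ G̃ (rootPath̃ ṽ) u ≡ δ ṽ u - δ r̃ u
  ∂-rootPath̃ ṽ u = trans (ToRoot.Source.∂-climb K ṽ (depth<K (πV ṽ)) u)
    (cong (λ t → δ ṽ u - δ t u) (over-root ([≟']-true {x = πV (ToRoot.Source.summit K ṽ)} {r} (ToRoot.Source.summit-stops K ṽ (depth<K (πV ṽ))))))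

  summit≡top : ∀ v → ToTop.Target.summit K v ≡ top v
  summit≡top v = ToTop.Target.summit-unique top top-stops top-moves K v (depth<K v)
    where
    top-stops : ∀ v → at-top v ≡ true → top v ≡ v
    top-stops v stops = by-root (v ≟ r)
      where
      by-root : Dec (v ≡ r) → top v ≡ v
      by-root (yes refl) = top-root
      by-root (no v≢r)   = top-free v v≢r (stopping⇒free v v≢r stops)
    top-moves : ∀ v (moving : at-top v ≡ false) → top v ≡ top (parent v (ToTop.Target.moving⇒≢root moving))
    top-moves v moving = top-dilated v v≢r (moving⇒dilated v v≢r moving)
      where v≢r = ToTop.Target.moving⇒≢root moving

  ∂-topPath : ∀ v u → ∂ G (topPath v) u ≡ δ v u - δ (top v) u
  ∂-topPath v u = trans (ToTop.Target.∂-climb K v (depth<K v) u) (cong (λ t → δ v u - δ t u) (summit≡top v))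

  summit̃-over : ∀ ṽ → πV (ToTop.Source.summit K ṽ) ≡ top (πV ṽ)
  summit̃-over ṽ = trans (ToTop.push-summit K ṽ) (summit≡top (πV ṽ))

  ∂-topPath̃ : ∀ ṽ u → ∂ G̃ (topPath̃ ṽ) u ≡ δ ṽ u - δ (ToTop.Source.summit K ṽ) u
  ∂-topPath̃ ṽ u = ToTop.Source.∂-climb K ṽ (depth<K (πV ṽ)) u

  top-dilated-vertex : ∀ v → DilV π v → DilV π (top v)
  top-dilated-vertex v v-dil = subst (DilV π) (summit≡top v)
    (ToTop.Target.summit-invariant (DilV π) step K v v-dil)
    where
    step : ∀ w (moving : at-top w ≡ false) → DilV π w → DilV π (parent w (ToTop.Target.moving⇒≢root moving))
    step w moving _ = dilE-end (not (dir w)) _ (moving⇒dilated w (ToTop.Target.moving⇒≢root moving) moving)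

  top-edge : ∀ e → DilE π e → top (src G e) ≡ top (tgt G e)
  top-edge e dil = top-component (src G e , src-dil) (tgt G e , tgt-dil)
    (walk⇒same-component (src G e , src-dil) (tgt G e , tgt-dil) (fwd e dil (here tgt-dil)))
    where
    src-dil : DilV π (src G e)
    src-dil = dilE-end false e dil
    tgt-dil : DilV π (tgt G e)
    tgt-dil = dilE-end true e dil

  -- The edges outside the tree, split into free and dilated ones, index the α's and the γ's.

  isTree dil : Edg G → Bool
  isTree e = does (treeEdge? e)
  dil e = does (dilE? π e)

  free-cotree dil-cotree : Edg G → Bool
  free-cotree e = not (dil e) ∧ not (isTree e)
  dil-cotree  e = dil e ∧ not (isTree e)

  a c : ℕ
  a = count free-cotree
  c = count dil-cotree

  eα : Fin a → Edg G
  eα = enum free-cotree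

  eγ : Fin c → Edg G
  eγ = enum dil-cotree

  cotree : ∀ e → isTree e ≡ false → ¬ IsTreeEdge e
  cotree e off = does-false (treeEdge? e) off

  eα-free : ∀ i → ¬ DilE π (eα i)
  eα-free i = does-false (dilE? π (eα i)) (not-true (proj₁ (∧-true (enum-member free-cotree i))))

  eα-cotree : ∀ i → ¬ IsTreeEdge (eα i)
  eα-cotree i = cotree (eα i) (not-true (proj₂ (∧-true (enum-member free-cotree i))))

  eγ-dil : ∀ k → DilE π (eγ k)
  eγ-dil k = does-true (dilE? π (eγ k)) (proj₁ (∧-true (enum-member dil-cotree k)))

  eγ-cotree : ∀ k → ¬ IsTreeEdge (eγ k)
  eγ-cotree k = cotree (eγ k) (not-true (proj₂ (∧-true (enum-member dil-cotree k))))

  eα≢eγ : ∀ i k → eα i ≢ eγ k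
  eα≢eγ i k eq = eα-free i (subst (DilE π) (sym eq) (eγ-dil k))

  -- The tops other than r index the β's.

  dilV : Vtx G → Bool
  dilV v = does (dilV? π v)

  isTop isOtherTop : Vtx G → Bool
  isTop v = dilV v ∧ at-top v
  isOtherTop v = isTop v ∧ not [ v ≟' r ]

  b : ℕ
  b = count isOtherTop

  t : Fin b → Vtx G
  t = enum isOtherTop

  t-top : ∀ j → isTop (t j) ≡ true
  t-top j = proj₁ (∧-true (enum-member isOtherTop j))

  t-dil : ∀ j → DilV π (t j)
  t-dil j = does-true (dilV? π (t j)) (proj₁ (∧-true (t-top j)))

  t≢r : ∀ j → t j ≢ r
  t≢r j t≡r = true≢false (trans (sym ([≟']-≡ t≡r)) (not-true (proj₂ (∧-true (enum-member isOtherTop j)))))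

  t-free : ∀ j → ¬ DilE π (par (t j) (t≢r j))
  t-free j = stopping⇒free (t j) (t≢r j) (proj₂ (∧-true (t-top j)))

  lift : Edg G → Edg G̃
  lift e = proj₁ (lift-edge e)

  lift-over : ∀ e → πE (lift e) ≡ e
  lift-over e = proj₂ (lift-edge e)

  α : Fin a → Chain G
  α i = fundamental {G} rootPath (eα i)

  γ : Fin c → Chain G
  γ k = fundamental {G} topPath (eγ k)

  α̃⁺ α̃⁻ : Fin a → Chain G̃
  α̃⁺ i = fundamental {G̃} rootPath̃ (lift (eα i))
  α̃⁻ i = ι* π ι (α̃⁺ i)

  γ̃ : Fin c → Chain G̃
  γ̃ k = fundamental {G̃} topPath̃ (lift (eγ k))

  t̃ : Fin b → Vtx G̃
  t̃ j = proj₁ (lift-vertex (t j))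

  t̃-over : ∀ j → πV (t̃ j) ≡ t j
  t̃-over j = proj₂ (lift-vertex (t j))

  -- Y j climbs from t̃ j to the first dilated vertex other than t j; both ends are fixed by ιV,
  -- so β̃ j = ι* (Y j) - Y j is a cycle.
  dilated-elsewhere : Fin b → Vtx G → Bool
  dilated-elsewhere j v = dilV v ∧ not [ v ≟' t j ]

  dilated-elsewhere-r : ∀ j → dilated-elsewhere j (πV r̃) ≡ true
  dilated-elsewhere-r j rewrite r̃-over | dec-true (dilV? π r) r-dil | [≟']-≢ (t≢r j ∘ sym) = refl

  module ToDilated (j : Fin b) = TG̃.Climb (dilated-elsewhere j ∘ πV) (dilated-elsewhere-r j)

  Y : Fin b → Chain G̃
  Y j = ToDilated.climb j K (t̃ j)

  β̃ : Fin b → Chain G̃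
  β̃ j ẽ = ι* π ι (Y j) ẽ - Y j ẽ

  α-cycle : ∀ i → IsCycle G (α i)
  α-cycle i = fundamental-cycle {G} rootPath (λ _ → r) ∂-rootPath (eα i) refl

  γ-cycle : ∀ k → IsCycle G (γ k)
  γ-cycle k = fundamental-cycle {G} topPath top ∂-topPath (eγ k) (sym (top-edge (eγ k) (eγ-dil k)))

  α̃⁺-cycle : ∀ i → IsCycle G̃ (α̃⁺ i)
  α̃⁺-cycle i = fundamental-cycle {G̃} rootPath̃ (λ _ → r̃) ∂-rootPath̃ (lift (eα i)) refl

  α̃⁻-cycle : ∀ i → IsCycle G̃ (α̃⁻ i)
  α̃⁻-cycle i = ι*-cycle (α̃⁺ i) (α̃⁺-cycle i)

  -- Both ends of the lift of a dilated edge climb to the unique lift of the top of its component.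
  γ̃-cycle : ∀ k → IsCycle G̃ (γ̃ k)
  γ̃-cycle k = fundamental-cycle {G̃} topPath̃ (ToTop.Source.summit K) ∂-topPath̃ ẽ
    (dilV-unique (top-dilated-vertex (tgt G e) (dilE-end true e (eγ-dil k))) tgt-summit src-summit)
    where
    e = eγ k
    ẽ = lift e
    tgt-summit : πV (ToTop.Source.summit K (tgt G̃ ẽ)) ≡ top (tgt G e)
    tgt-summit = trans (summit̃-over (tgt G̃ ẽ)) (cong top (trans (sym (tgt-comm ẽ)) (cong (tgt G) (lift-over e))))
    src-summit : πV (ToTop.Source.summit K (src G̃ ẽ)) ≡ top (tgt G e)
    src-summit = trans (summit̃-over (src G̃ ẽ))
      (trans (cong top (trans (sym (src-comm ẽ)) (cong (src G) (lift-over e)))) (top-edge e (eγ-dil k)))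

  δ-ιV : ∀ x u → DilV π (πV x) → δ x (ιV u) ≡ δ x u
  δ-ιV x u x-dil = cong ind (trans (sym (ιV-≟ x u)) (cong (λ y → [ y ≟' u ]) (ιV-dilated x x-dil)))

  ∂-Y : ∀ j u → ∂ G̃ (Y j) u ≡ δ (t̃ j) u - δ (ToDilated.summit j K (t̃ j)) u
  ∂-Y j u = ToDilated.∂-climb j K (t̃ j) (depth<K (πV (t̃ j))) u

  Y-summit-dil : ∀ j → DilV π (πV (ToDilated.summit j K (t̃ j)))
  Y-summit-dil j = does-true (dilV? π _) (proj₁ (∧-true (ToDilated.summit-stops j K (t̃ j) (depth<K (πV (t̃ j))))))

  t̃-dil : ∀ j → DilV π (πV (t̃ j))
  t̃-dil j = subst (DilV π) (sym (t̃-over j)) (t-dil j)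

  β̃-cycle : ∀ j → IsCycle G̃ (β̃ j)
  β̃-cycle j u = begin
    ∂ G̃ (β̃ j) u                              ≡⟨ ∂-distrib-- G̃ (ι* π ι (Y j)) (Y j) u ⟩
    ∂ G̃ (ι* π ι (Y j)) u - ∂ G̃ (Y j) u        ≡⟨ cong (_- ∂ G̃ (Y j) u) (trans (∂-ι* (Y j) u) (trans (∂-Y j (ιV u))
                                                   (trans (cong₂ _-_ (δ-ιV _ u (t̃-dil j)) (δ-ιV _ u (Y-summit-dil j))) (sym (∂-Y j u))))) ⟩
    ∂ G̃ (Y j) u - ∂ G̃ (Y j) u                 ≡⟨ ZP.+-inverseʳ (∂ G̃ (Y j) u) ⟩
    + 0                                      ∎
    where open ≡-Reasoning

  ια⁺ : ∀ i → ι* π ι (α̃⁺ i) ≈[ G̃ ] α̃⁻ i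
  ια⁺ i ẽ = refl

  ια⁻ : ∀ i → ι* π ι (α̃⁻ i) ≈[ G̃ ] α̃⁺ i
  ια⁻ i ẽ = cong (α̃⁺ i) (ι-involutive ẽ)

  πα⁺ : ∀ i → π* π (α̃⁺ i) ≈[ G ] α i
  πα⁺ i e = trans (push-fundamental {G̃} {G} πV πE tgt-comm src-comm rootPath̃ rootPath (ToRoot.push-climb K) (lift (eα i)) e)
                  (cong (λ x → fundamental {G} rootPath x e) (lift-over (eα i)))

  πα⁻ : ∀ i → π* π (α̃⁻ i) ≈[ G ] α i
  πα⁻ i e = trans (π*-ι* (α̃⁺ i) e) (πα⁺ i e)

  π^*-cong : ∀ {x y} → x ≈[ G ] y → π^* π x ≈[ G̃ ] π^* π y
  π^*-cong x≈y ẽ = cong ((if does (dilE? π (πE ẽ)) then + 2 else + 1) *_) (x≈y (πE ẽ))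

  π^α : ∀ i → π^* π (α i) ≈[ G̃ ] (α̃⁺ i +[ G̃ ] α̃⁻ i)
  π^α i ẽ = trans (π^*-cong (λ e → sym (πα⁺ i e)) ẽ) (π^*-π* (α̃⁺ i) ẽ)

  ιβ : ∀ j → ι* π ι (β̃ j) ≈[ G̃ ] negᶜ G̃ (β̃ j)
  ιβ j ẽ = trans (cong (λ x → Y j x - Y j (ι ẽ)) (ι-involutive ẽ)) (swap-difference (Y j ẽ) (Y j (ι ẽ)))
    where
    swap-difference : ∀ x y → x - y ≡ - (y - x)
    swap-difference = solve-∀

  πβ : ∀ j → π* π (β̃ j) ≈[ G ] 0ᶜ G
  πβ j e = trans (push-distrib-- πE (ι* π ι (Y j)) (Y j) e)
                 (trans (cong (_- π* π (Y j) e) (π*-ι* (Y j) e)) (ZP.+-inverseʳ (π* π (Y j) e)))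

  πγ : ∀ k → π* π (γ̃ k) ≈[ G ] γ k
  πγ k e = trans (push-fundamental {G̃} {G} πV πE tgt-comm src-comm topPath̃ topPath (ToTop.push-climb K) (lift (eγ k)) e)
                 (cong (λ x → fundamental {G} topPath x e) (lift-over (eγ k)))

  topPath̃-free : ∀ ṽ x → ¬ DilE π (πE x) → topPath̃ ṽ x ≡ + 0
  topPath̃-free ṽ x free = ToTop.Source.climb-support K ṽ x (λ w w≢r̃ moving _ eq →
    free (subst (DilE π) (trans (sym (par̃-over w w≢r̃ (≢r̃ w≢r̃))) (cong πE eq)) (moving⇒dilated (πV w) (≢r̃ w≢r̃) moving)))

  γ̃-free : ∀ k x → ¬ DilE π (πE x) → γ̃ k x ≡ + 0
  γ̃-free k x free = trans (cong₂ (λ a b → a - topPath̃ _ x + b) (δ-≢ lift≢x) (topPath̃-free _ x free))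
                          (cong (λ y → + 0 - y + + 0) (topPath̃-free _ x free))
    where
    lift≢x : lift (eγ k) ≢ x
    lift≢x eq = free (subst (DilE π) (trans (sym (lift-over (eγ k))) (cong πE eq)) (eγ-dil k))

  ιγ : ∀ k → ι* π ι (γ̃ k) ≈[ G̃ ] γ̃ k
  ιγ k ẽ with dilE? π (πE ẽ)
  ... | yes dil = cong (γ̃ k) (ι-dilated ẽ dil)
  ... | no free = trans (γ̃-free k (ι ẽ) (free ∘ subst (DilE π) (ι-over ẽ))) (sym (γ̃-free k ẽ free))

  π^γ : ∀ k → π^* π (γ k) ≈[ G̃ ] scaleᶜ G̃ (+ 2) (γ̃ k)
  π^γ k ẽ = trans (π^*-cong (λ e → sym (πγ k e)) ẽ)
    (trans (π^*-π* (γ̃ k) ẽ) (trans (cong (λ x → γ̃ k ẽ + x) (ιγ k ẽ)) (double (γ̃ k ẽ))))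
    where
    double : ∀ x → x + x ≡ + 2 * x
    double = solve-∀

  -- A basis of H₁(G): α's and γ's are dual to the evaluations at their cotree edges.

  cotree-edge : ∀ e → ¬ IsTreeEdge e → (∃[ i ] eα i ≡ e) ⊎ (∃[ k ] eγ k ≡ e)
  cotree-edge e off = by-dilation (dilE? π e)
    where
    off-tree : isTree e ≡ false
    off-tree = dec-false (treeEdge? e) off
    by-dilation : Dec (DilE π e) → (∃[ i ] eα i ≡ e) ⊎ (∃[ k ] eγ k ≡ e)
    by-dilation (yes dil-e) = inj₂ (_ , enum-index dil-cotree e member)
      where
      member : dil-cotree e ≡ true
      member = cong₂ _∧_ (dec-true (dilE? π e) dil-e) (cong not off-tree)
    by-dilation (no free) = inj₁ (_ , enum-index free-cotree e member)
      where
      member : free-cotree e ≡ true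
      member = cong₂ _∧_ (cong not (dec-false (dilE? π e) free)) (cong not off-tree)

  α-cotree : ∀ i x → ¬ IsTreeEdge x → α i x ≡ δ (eα i) x
  α-cotree i x off = fundamental-off-paths {G} rootPath (eα i) x (λ v → ToRoot.Target.climb-off-tree K v x off)

  γ-cotree : ∀ k x → ¬ IsTreeEdge x → γ k x ≡ δ (eγ k) x
  γ-cotree k x off = fundamental-off-paths {G} topPath (eγ k) x (λ v → ToTop.Target.climb-off-tree K v x off)

  δ-enum : ∀ {n} (p : Fin n → Bool) j i → δ (enum p i) (enum p j) ≡ δ j i
  δ-enum p j i = trans (δ-injective (enum p) (enum-injective p) i j) (δ-sym i j)

  dualG : Fin (a ℕ.+ c) → Chain G
  dualG = (δ ∘ eα) ⊕ (δ ∘ eγ)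

  basisG : IsBasis G (α ⊕ γ)
  basisG = basis-from-dual G (α ⊕ γ) dualG (⊕-all (IsCycle G) α γ α-cycle γ-cycle)
    (⊕-dual α (δ ∘ eα) γ (δ ∘ eγ)
      (λ j i → trans (⟨δ,⟩ (eα j) (α i)) (trans (α-cotree i (eα j) (eα-cotree j)) (δ-enum free-cotree j i)))
      (λ j k → trans (⟨δ,⟩ (eα j) (γ k)) (trans (γ-cotree k (eα j) (eα-cotree j)) (δ-≢ (eα≢eγ j k ∘ sym))))
      (λ k i → trans (⟨δ,⟩ (eγ k) (α i)) (trans (α-cotree i (eγ k) (eγ-cotree k)) (δ-≢ (eα≢eγ i k))))
      (λ k k′ → trans (⟨δ,⟩ (eγ k) (γ k′)) (trans (γ-cotree k′ (eγ k) (eγ-cotree k)) (δ-enum dil-cotree k k′))))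
    detects
    where
    detects : ∀ z → IsCycle G z → (∀ j → ⟨ dualG j , z ⟩ ≡ + 0) → ∀ e → z e ≡ + 0
    detects z z-cycle dual≡0 = TG.cycle-vanishing-off-tree z z-cycle off-tree
      where
      vanishes : Chain G → Set
      vanishes w = ⟨ w , z ⟩ ≡ + 0
      off-tree : ∀ e → ¬ IsTreeEdge e → z e ≡ + 0
      off-tree e off with cotree-edge e off
      ... | inj₁ (i , refl) = trans (sym (⟨δ,⟩ (eα i) z)) (⊕-all-left vanishes (δ ∘ eα) (δ ∘ eγ) dual≡0 i)
      ... | inj₂ (k , refl) = trans (sym (⟨δ,⟩ (eγ k) z)) (⊕-all-right vanishes (δ ∘ eα) (δ ∘ eγ) dual≡0 k)

  CotreeG̃ : Edg G̃ → Set
  CotreeG̃ x = ¬ TG̃.IsTreeEdge x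

  over-cotree : ∀ x → ¬ IsTreeEdge (πE x) → CotreeG̃ x
  over-cotree x off (w , w≢r̃ , refl) = off (πV w , ≢r̃ w≢r̃ , sym (par̃-over w w≢r̃ (≢r̃ w≢r̃)))

  ẽα : Fin a → Edg G̃
  ẽα i = lift (eα i)

  g̃ : Fin c → Edg G̃
  g̃ k = lift (eγ k)

  t̃≢r̃ : ∀ j → t̃ j ≢ r̃
  t̃≢r̃ j t̃≡r̃ = t≢r j (trans (sym (t̃-over j)) (trans (cong πV t̃≡r̃) r̃-over))

  -- The free parent edge of t j has the tree edge f̃⁺ j and the cotree edge f̃⁻ j above it.
  f̃⁺ f̃⁻ : Fin b → Edg G̃
  f̃⁺ j = par̃ (t̃ j) (t̃≢r̃ j)
  f̃⁻ j = ι (f̃⁺ j)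

  f̃⁺-over : ∀ j → πE (f̃⁺ j) ≡ par (t j) (t≢r j)
  f̃⁺-over j = trans (par̃-over (t̃ j) (t̃≢r̃ j) (≢r̃ (t̃≢r̃ j))) (TG.par-cong (t̃-over j) (≢r̃ (t̃≢r̃ j)) (t≢r j))

  f̃⁻-over : ∀ j → πE (f̃⁻ j) ≡ par (t j) (t≢r j)
  f̃⁻-over j = trans (ι-over (f̃⁺ j)) (f̃⁺-over j)

  f̃-free : ∀ j → ¬ DilE π (πE (f̃⁺ j))
  f̃-free j dil = t-free j (subst (DilE π) (f̃⁺-over j) dil)

  ẽα-cotree : ∀ i → CotreeG̃ (ẽα i)
  ẽα-cotree i = over-cotree (ẽα i) (subst (λ e → ¬ IsTreeEdge e) (sym (lift-over (eα i))) (eα-cotree i))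

  ιẽα-cotree : ∀ i → CotreeG̃ (ι (ẽα i))
  ιẽα-cotree i = over-cotree (ι (ẽα i))
    (subst (λ e → ¬ IsTreeEdge e) (sym (trans (ι-over (ẽα i)) (lift-over (eα i)))) (eα-cotree i))

  g̃-cotree : ∀ k → CotreeG̃ (g̃ k)
  g̃-cotree k = over-cotree (g̃ k) (subst (λ e → ¬ IsTreeEdge e) (sym (lift-over (eγ k))) (eγ-cotree k))

  ιg̃≡g̃ : ∀ k → ι (g̃ k) ≡ g̃ k
  ιg̃≡g̃ k = ι-dilated (g̃ k) (subst (DilE π) (sym (lift-over (eγ k))) (eγ-dil k))

  -- A parent edge of T̃ above par (t j) belongs to t̃ j, the only vertex above the dilated t j.
  f̃⁻-cotree : ∀ j → CotreeG̃ (f̃⁻ j)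
  f̃⁻-cotree j (w , w≢r̃ , eq) = ι-free (f̃⁺ j) (f̃-free j) (trans (sym eq) (TG̃.par-cong w≡t̃ w≢r̃ (t̃≢r̃ j)))
    where
    w≡t̃ : w ≡ t̃ j
    w≡t̃ = dilV-unique (t-dil j)
      (TG.par-injective (πV w) (t j) (≢r̃ w≢r̃) (t≢r j)
        (trans (sym (par̃-over w w≢r̃ (≢r̃ w≢r̃))) (trans (cong πE eq) (f̃⁻-over j))))
      (t̃-over j)

  lifts-differ : ∀ {x y} → πE x ≢ πE y → x ≢ y
  lifts-differ differ refl = differ refl

  ẽα-injective : ∀ {i i′} → ẽα i ≡ ẽα i′ → i ≡ i′
  ẽα-injective eq = enum-injective free-cotree (trans (sym (lift-over _)) (trans (cong πE eq) (lift-over _)))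

  g̃-injective : ∀ {k k′} → g̃ k ≡ g̃ k′ → k ≡ k′
  g̃-injective eq = enum-injective dil-cotree (trans (sym (lift-over _)) (trans (cong πE eq) (lift-over _)))

  ẽα≢ιẽα : ∀ i i′ → ẽα i ≢ ι (ẽα i′)
  ẽα≢ιẽα i i′ eq = ι-free (ẽα i′) (eα-free i′ ∘ subst (DilE π) (lift-over (eα i′)))
    (sym (trans (cong ẽα (sym same-index)) eq))
    where
    same-index : i ≡ i′
    same-index = enum-injective free-cotree
      (trans (sym (lift-over (eα i))) (trans (cong πE eq) (trans (ι-over (ẽα i′)) (lift-over (eα i′)))))

  ẽα≢g̃ : ∀ i k → ẽα i ≢ g̃ k
  ẽα≢g̃ i k = lifts-differ (λ eq → eα≢eγ i k (trans (sym (lift-over (eα i))) (trans eq (lift-over (eγ k)))))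

  ιẽα≢g̃ : ∀ i k → ι (ẽα i) ≢ g̃ k
  ιẽα≢g̃ i k = lifts-differ (λ eq → eα≢eγ i k
    (trans (sym (lift-over (eα i))) (trans (sym (ι-over (ẽα i))) (trans eq (lift-over (eγ k))))))

  ẽα≢f̃⁻ : ∀ i j → ẽα i ≢ f̃⁻ j
  ẽα≢f̃⁻ i j = lifts-differ (λ eq → eα-cotree i (t j , t≢r j , sym (trans (sym (lift-over (eα i))) (trans eq (f̃⁻-over j)))))

  g̃≢f̃⁻ : ∀ k j → g̃ k ≢ f̃⁻ j
  g̃≢f̃⁻ k j = lifts-differ (λ eq → eγ-cotree k (t j , t≢r j , sym (trans (sym (lift-over (eγ k))) (trans eq (f̃⁻-over j)))))

  α̃⁺-cotree : ∀ i x → CotreeG̃ x → α̃⁺ i x ≡ δ (ẽα i) x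
  α̃⁺-cotree i x off = fundamental-off-paths {G̃} rootPath̃ (ẽα i) x (λ ṽ → ToRoot.Source.climb-off-tree K ṽ x off)

  α̃⁻-ι : ∀ i x → α̃⁻ i (ι x) ≡ α̃⁺ i x
  α̃⁻-ι i x = cong (α̃⁺ i) (ι-involutive x)

  γ̃-cotree : ∀ k x → CotreeG̃ x → γ̃ k x ≡ δ (g̃ k) x
  γ̃-cotree k x off = fundamental-off-paths {G̃} topPath̃ (g̃ k) x (λ ṽ → ToTop.Source.climb-off-tree K ṽ x off)

  Y-cotree : ∀ j x → CotreeG̃ x → Y j x ≡ + 0
  Y-cotree j x off = ToDilated.climb-off-tree j K (t̃ j) x off

  β̃-cotree : ∀ j x → CotreeG̃ x → CotreeG̃ (ι x) → β̃ j x ≡ + 0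
  β̃-cotree j x off ι-off = cong₂ _-_ (Y-cotree j (ι x) ι-off) (Y-cotree j x off)

  t̃-moving : ∀ j → dilated-elsewhere j (πV (t̃ j)) ≡ false
  t̃-moving j rewrite t̃-over j | [≟']-refl (t j) = BP.∧-zeroʳ (dilV (t j))

  -- Y j starts with the edge f̃⁺ j and never returns to it.
  Y-f̃⁺ : ∀ j → Y j (f̃⁺ j) ≡ sgn (dir (t j))
  Y-f̃⁺ j = begin
    Y j (f̃⁺ j)
      ≡⟨ ToDilated.climb-unfold j (ΣN depth) (t̃ j) (t̃-moving j) (f̃⁺ j) ⟩
    sgn (dir (πV (t̃ j))) * δ (f̃⁺ j) (f̃⁺ j) + ToDilated.climb j (ΣN depth) (TG̃.parent (t̃ j) (t̃≢r̃ j)) (f̃⁺ j)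
      ≡⟨ cong₂ _+_ (cong₂ _*_ (cong (sgn ∘ dir) (t̃-over j)) (δ-refl (f̃⁺ j)))
                   (ToDilated.climb-support j (ΣN depth) _ (f̃⁺ j) only-deeper) ⟩
    sgn (dir (t j)) * + 1 + + 0
      ≡⟨ ZP.+-identityʳ _ ⟩
    sgn (dir (t j)) * + 1
      ≡⟨ ZP.*-identityʳ _ ⟩
    sgn (dir (t j)) ∎
    where
    open ≡-Reasoning
    only-deeper : ∀ w (w≢r̃ : w ≢ r̃) → _ → depth (πV w) ≤ depth (πV (TG̃.parent (t̃ j) (t̃≢r̃ j))) → par̃ w w≢r̃ ≢ f̃⁺ j
    only-deeper w w≢r̃ _ shallow eq with TG̃.par-injective w (t̃ j) w≢r̃ (t̃≢r̃ j) eq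
    ... | refl = NP.<⇒≱ (RootedTree.parent-shallower T̃ (t̃ j) (t̃≢r̃ j)) shallow

  Y-f̃⁺-other : ∀ j j′ → j ≢ j′ → Y j (f̃⁺ j′) ≡ + 0
  Y-f̃⁺-other j j′ j≢j′ = ToDilated.climb-support j K (t̃ j) (f̃⁺ j′) stops-at-t̃
    where
    stops-at-t̃ : ∀ w (w≢r̃ : w ≢ r̃) → dilated-elsewhere j (πV w) ≡ false → _ → par̃ w w≢r̃ ≢ f̃⁺ j′
    stops-at-t̃ w w≢r̃ moving _ eq with TG̃.par-injective w (t̃ j′) w≢r̃ (t̃≢r̃ j′) eq
    ... | refl = true≢false (trans (sym stops) moving)
      where
      stops : dilated-elsewhere j (πV (t̃ j′)) ≡ true
      stops = trans (cong (dilated-elsewhere j) (t̃-over j′)) (cong₂ _∧_ (dec-true (dilV? π (t j′)) (t-dil j′))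
        (cong not ([≟']-≢ (j≢j′ ∘ sym ∘ enum-injective isOtherTop))))

  β̃-f̃⁻ : ∀ j j′ → β̃ j (f̃⁻ j′) ≡ Y j (f̃⁺ j′)
  β̃-f̃⁻ j j′ = trans (cong₂ _-_ (cong (Y j) (ι-involutive (f̃⁺ j′))) (Y-cotree j (f̃⁻ j′) (f̃⁻-cotree j′)))
                    (ZP.+-identityʳ _)

  -- Every cotree edge of T̃ is one of the edges the dual weights below evaluate at.
  CoverCotreeEdge : Edg G̃ → Set
  CoverCotreeEdge ẽ = (∃[ i ] ẽ ≡ ẽα i) ⊎ (∃[ i ] ẽ ≡ ι (ẽα i)) ⊎ (∃[ k ] ẽ ≡ g̃ k) ⊎ (∃[ j ] ẽ ≡ f̃⁻ j)

  over-cotree-edge : ∀ ẽ → ¬ IsTreeEdge (πE ẽ) → CoverCotreeEdge ẽ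
  over-cotree-edge ẽ off with cotree-edge (πE ẽ) off
  ... | inj₁ (i , eαi≡) with free-fibreE {ẽα i} {ẽ} (eα-free i ∘ subst (DilE π) (lift-over (eα i)))
                                               (sym (trans (lift-over (eα i)) eαi≡))
  ...   | inj₁ ẽ≡ = inj₁ (i , ẽ≡)
  ...   | inj₂ ẽ≡ = inj₂ (inj₁ (i , ẽ≡))
  over-cotree-edge ẽ off | inj₂ (k , eγk≡) =
    inj₂ (inj₂ (inj₁ (k , dilE-unique (eγ-dil k) (sym eγk≡) (lift-over (eγ k)))))

  -- Above the parent edge of w, the tree edge of T̃ is the lift at the end over w; any other lift
  -- needs two lifts at a dilated vertex, i.e. w is a top t j, and it is then f̃⁻ j.
  over-tree-edge : ∀ ẽ → CotreeG̃ ẽ → IsTreeEdge (πE ẽ) → ∃[ j ] ẽ ≡ f̃⁻ j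
  over-tree-edge ẽ off (w , w≢r , par-w) = by-vertex (dilV? π w)
    where
    x̃ = end {G̃} (dir w) ẽ
    x̃-over : πV x̃ ≡ w
    x̃-over = trans (sym (end-comm (dir w) ẽ)) (trans (cong (end {G} (dir w)) (sym par-w)) (par-end w w≢r))
    x̃≢r̃ : x̃ ≢ r̃
    x̃≢r̃ x̃≡r̃ = w≢r (trans (sym x̃-over) (trans (cong πV x̃≡r̃) r̃-over))
    ẽ₀ = par̃ x̃ x̃≢r̃
    ẽ₀-over : πE ẽ₀ ≡ πE ẽ
    ẽ₀-over = trans (par̃-over x̃ x̃≢r̃ (≢r̃ x̃≢r̃)) (trans (TG.par-cong x̃-over (≢r̃ x̃≢r̃) w≢r) par-w)
    ẽ₀-at : end {G̃} (dir w) ẽ₀ ≡ x̃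
    ẽ₀-at = trans (cong (λ u → end {G̃} (dir u) ẽ₀) (sym x̃-over)) (par̃-end x̃ x̃≢r̃)
    in-tree : ẽ₀ ≢ ẽ
    in-tree ẽ₀≡ẽ = off (x̃ , x̃≢r̃ , ẽ₀≡ẽ)
    by-vertex : Dec (DilV π w) → ∃[ j ] ẽ ≡ f̃⁻ j
    by-vertex (no free) = ⊥-elim (in-tree (lift-at-unique (dir w) x̃ (free ∘ subst (DilV π) x̃-over) ẽ₀-over ẽ₀-at refl))
    by-vertex (yes w-dil) = by-edge (dilE? π (πE ẽ))
      where
      by-edge : Dec (DilE π (πE ẽ)) → ∃[ j ] ẽ ≡ f̃⁻ j
      by-edge (yes dil) = ⊥-elim (in-tree (dilE-unique dil ẽ₀-over refl))
      by-edge (no free) with free-fibreE {f̃⁺ j} {ẽ} (f̃-free j) (sym f̃⁺-over-ẽ)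
        where
        other-top : isOtherTop w ≡ true
        other-top = cong₂ _∧_ (cong₂ _∧_ (dec-true (dilV? π w) w-dil)
                      (trans (at-top-≢r w w≢r) (cong not (dec-false (dilE? π (par w w≢r)) (free ∘ subst (DilE π) par-w)))))
                      (cong not ([≟']-≢ w≢r))
        j = index isOtherTop w other-top
        f̃⁺-over-ẽ : πE (f̃⁺ j) ≡ πE ẽ
        f̃⁺-over-ẽ = trans (f̃⁺-over j) (trans (TG.par-cong (enum-index isOtherTop w other-top) (t≢r j) w≢r) par-w)
      ... | inj₁ ẽ≡f̃⁺ = ⊥-elim (off (t̃ _ , t̃≢r̃ _ , sym ẽ≡f̃⁺))
      ... | inj₂ ẽ≡f̃⁻ = _ , ẽ≡f̃⁻

  cover-cotree-edge : ∀ ẽ → CotreeG̃ ẽ → CoverCotreeEdge ẽ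
  cover-cotree-edge ẽ off with treeEdge? (πE ẽ)
  ... | no off-below = over-cotree-edge ẽ off-below
  ... | yes on-tree  = inj₂ (inj₂ (inj₂ (over-tree-edge ẽ off on-tree)))

  -- Dual weights. Since ι (f̃⁻ j) is a tree edge, α̃⁻ i = ι* α̃⁺ i may be non-zero on f̃⁻ j;
  -- wβ j is corrected accordingly.
  correction : Fin b → Fin a → ℤ
  correction j i = α̃⁻ i (f̃⁻ j)

  w⁺ w⁻ : Fin a → Chain G̃
  w⁺ i = δ (ẽα i)
  w⁻ i = δ (ι (ẽα i))

  wβ : Fin b → Chain G̃
  wβ j e = sgn (dir (t j)) * (δ (f̃⁻ j) e - lincomb {G̃} (correction j) w⁻ e)

  wγ : Fin c → Chain G̃
  wγ k = δ (g̃ k)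

  ⟨wβ,⟩ : ∀ j x → ⟨ wβ j , x ⟩ ≡ sgn (dir (t j)) * (x (f̃⁻ j) - ΣZ (λ i → correction j i * x (ι (ẽα i))))
  ⟨wβ,⟩ j x = begin
    ⟨ wβ j , x ⟩
      ≡⟨ ⟨⟩-comm (wβ j) x ⟩
    ⟨ x , wβ j ⟩
      ≡⟨ ⟨⟩-scale x s (λ e → δ (f̃⁻ j) e - lincomb {G̃} (correction j) w⁻ e) ⟩
    s * ⟨ x , (λ e → δ (f̃⁻ j) e - lincomb {G̃} (correction j) w⁻ e) ⟩
      ≡⟨ cong (s *_) (⟨⟩-distrib-- x (δ (f̃⁻ j)) (lincomb {G̃} (correction j) w⁻)) ⟩
    s * (⟨ x , δ (f̃⁻ j) ⟩ - ⟨ x , lincomb {G̃} (correction j) w⁻ ⟩)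
      ≡⟨ cong (s *_) (cong₂ _-_ (⟨,δ⟩ x (f̃⁻ j)) (⟨⟩-lincomb {G̃} x (correction j) w⁻)) ⟩
    s * (x (f̃⁻ j) - ΣZ (λ i → correction j i * ⟨ x , w⁻ i ⟩))
      ≡⟨ cong (λ y → s * (x (f̃⁻ j) - y)) (ΣZ-cong (λ i → cong (correction j i *_) (⟨,δ⟩ x (ι (ẽα i))))) ⟩
    s * (x (f̃⁻ j) - ΣZ (λ i → correction j i * x (ι (ẽα i)))) ∎
    where
    open ≡-Reasoning
    s = sgn (dir (t j))

  ⟨wβ,⟩-zero : ∀ j x → x (f̃⁻ j) ≡ + 0 → (∀ i → x (ι (ẽα i)) ≡ + 0) → ⟨ wβ j , x ⟩ ≡ + 0
  ⟨wβ,⟩-zero j x at-f̃⁻ at-ιẽα = trans (⟨wβ,⟩ j x) (trans (cong (λ y → sgn (dir (t j)) * y)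
    (cong₂ _-_ at-f̃⁻ (ΣZ-zero (λ i → trans (cong (correction j i *_) (at-ιẽα i)) (ZP.*-zeroʳ (correction j i))))))
    (ZP.*-zeroʳ (sgn (dir (t j)))))

  δ-ẽα : ∀ i i′ → δ (ẽα i) (ẽα i′) ≡ δ i′ i
  δ-ẽα i i′ = trans (δ-injective ẽα ẽα-injective i i′) (δ-sym i i′)

  at-ẽα : ∀ (x : Chain G̃) i → ⟨ w⁺ i , x ⟩ ≡ x (ẽα i)
  at-ẽα x i = ⟨δ,⟩ (ẽα i) x

  at-ιẽα : ∀ (x : Chain G̃) i → ⟨ w⁻ i , x ⟩ ≡ x (ι (ẽα i))
  at-ιẽα x i = ⟨δ,⟩ (ι (ẽα i)) x

  at-g̃ : ∀ (x : Chain G̃) k → ⟨ wγ k , x ⟩ ≡ x (g̃ k)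
  at-g̃ x k = ⟨δ,⟩ (g̃ k) x

  w⁺-α̃⁺ : ∀ i′ i → ⟨ w⁺ i′ , α̃⁺ i ⟩ ≡ δ i′ i
  w⁺-α̃⁺ i′ i = trans (at-ẽα _ i′) (trans (α̃⁺-cotree i _ (ẽα-cotree i′)) (δ-ẽα i i′))

  w⁺-α̃⁻ : ∀ i′ i → ⟨ w⁺ i′ , α̃⁻ i ⟩ ≡ + 0
  w⁺-α̃⁻ i′ i = trans (at-ẽα _ i′) (trans (α̃⁺-cotree i _ (ιẽα-cotree i′)) (δ-≢ (ẽα≢ιẽα i i′)))

  w⁺-β̃ : ∀ i′ j → ⟨ w⁺ i′ , β̃ j ⟩ ≡ + 0
  w⁺-β̃ i′ j = trans (at-ẽα _ i′) (β̃-cotree j _ (ẽα-cotree i′) (ιẽα-cotree i′))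

  w⁺-γ̃ : ∀ i′ k → ⟨ w⁺ i′ , γ̃ k ⟩ ≡ + 0
  w⁺-γ̃ i′ k = trans (at-ẽα _ i′) (trans (γ̃-cotree k _ (ẽα-cotree i′)) (δ-≢ (ẽα≢g̃ i′ k ∘ sym)))

  w⁻-α̃⁺ : ∀ i′ i → ⟨ w⁻ i′ , α̃⁺ i ⟩ ≡ + 0
  w⁻-α̃⁺ i′ i = trans (at-ιẽα _ i′) (trans (α̃⁺-cotree i _ (ιẽα-cotree i′)) (δ-≢ (ẽα≢ιẽα i i′)))

  w⁻-α̃⁻ : ∀ i′ i → ⟨ w⁻ i′ , α̃⁻ i ⟩ ≡ δ i′ i
  w⁻-α̃⁻ i′ i = trans (at-ιẽα _ i′) (trans (α̃⁻-ι i (ẽα i′)) (trans (α̃⁺-cotree i _ (ẽα-cotree i′)) (δ-ẽα i i′)))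

  w⁻-β̃ : ∀ i′ j → ⟨ w⁻ i′ , β̃ j ⟩ ≡ + 0
  w⁻-β̃ i′ j = trans (at-ιẽα _ i′)
    (β̃-cotree j _ (ιẽα-cotree i′) (subst CotreeG̃ (sym (ι-involutive (ẽα i′))) (ẽα-cotree i′)))

  w⁻-γ̃ : ∀ i′ k → ⟨ w⁻ i′ , γ̃ k ⟩ ≡ + 0
  w⁻-γ̃ i′ k = trans (at-ιẽα _ i′) (trans (γ̃-cotree k _ (ιẽα-cotree i′)) (δ-≢ (ιẽα≢g̃ i′ k ∘ sym)))

  wβ-α̃⁺ : ∀ j i → ⟨ wβ j , α̃⁺ i ⟩ ≡ + 0
  wβ-α̃⁺ j i = ⟨wβ,⟩-zero j (α̃⁺ i) (trans (α̃⁺-cotree i _ (f̃⁻-cotree j)) (δ-≢ (ẽα≢f̃⁻ i j)))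
    (λ i′ → trans (α̃⁺-cotree i _ (ιẽα-cotree i′)) (δ-≢ (ẽα≢ιẽα i i′)))

  wβ-α̃⁻ : ∀ j i → ⟨ wβ j , α̃⁻ i ⟩ ≡ + 0
  wβ-α̃⁻ j i = trans (⟨wβ,⟩ j (α̃⁻ i)) (trans (cong (λ y → sgn (dir (t j)) * (correction j i - y))
      (trans (ΣZ-cong (λ i′ → cong (correction j i′ *_) (trans (sym (at-ιẽα (α̃⁻ i) i′)) (w⁻-α̃⁻ i′ i))))
             (ΣZ-δʳ (correction j) i)))
    (trans (cong (sgn (dir (t j)) *_) (ZP.+-inverseʳ (correction j i))) (ZP.*-zeroʳ (sgn (dir (t j))))))

  wβ-β̃ : ∀ j j′ → ⟨ wβ j , β̃ j′ ⟩ ≡ δ j j′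
  wβ-β̃ j j′ = trans (⟨wβ,⟩ j (β̃ j′)) (trans (cong (λ y → sgn (dir (t j)) * (β̃ j′ (f̃⁻ j) - y))
      (ΣZ-zero (λ i → trans (cong (correction j i *_)
        (β̃-cotree j′ _ (ιẽα-cotree i) (subst CotreeG̃ (sym (ι-involutive (ẽα i))) (ẽα-cotree i)))) (ZP.*-zeroʳ (correction j i)))))
    (trans (cong (λ y → sgn (dir (t j)) * y) (trans (ZP.+-identityʳ _) (β̃-f̃⁻ j′ j))) (by-index (j ≟ j′))))
    where
    by-index : Dec (j ≡ j′) → sgn (dir (t j)) * Y j′ (f̃⁺ j) ≡ δ j j′
    by-index (yes refl) = trans (cong (sgn (dir (t j)) *_) (Y-f̃⁺ j)) (trans (sgn-squared (dir (t j))) (sym (δ-refl j)))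
    by-index (no j≢j′)  = trans (cong (sgn (dir (t j)) *_) (Y-f̃⁺-other j′ j (j≢j′ ∘ sym)))
                                (trans (ZP.*-zeroʳ (sgn (dir (t j)))) (sym (δ-≢ j≢j′)))

  wβ-γ̃ : ∀ j k → ⟨ wβ j , γ̃ k ⟩ ≡ + 0
  wβ-γ̃ j k = ⟨wβ,⟩-zero j (γ̃ k) (trans (γ̃-cotree k _ (f̃⁻-cotree j)) (δ-≢ (g̃≢f̃⁻ k j)))
    (λ i → trans (γ̃-cotree k _ (ιẽα-cotree i)) (δ-≢ (ιẽα≢g̃ i k ∘ sym)))

  wγ-α̃⁺ : ∀ k i → ⟨ wγ k , α̃⁺ i ⟩ ≡ + 0
  wγ-α̃⁺ k i = trans (at-g̃ _ k) (trans (α̃⁺-cotree i _ (g̃-cotree k)) (δ-≢ (ẽα≢g̃ i k)))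

  wγ-α̃⁻ : ∀ k i → ⟨ wγ k , α̃⁻ i ⟩ ≡ + 0
  wγ-α̃⁻ k i = trans (at-g̃ _ k) (trans (cong (α̃⁺ i) (ιg̃≡g̃ k)) (trans (α̃⁺-cotree i _ (g̃-cotree k)) (δ-≢ (ẽα≢g̃ i k))))

  wγ-β̃ : ∀ k j → ⟨ wγ k , β̃ j ⟩ ≡ + 0
  wγ-β̃ k j = trans (at-g̃ _ k) (β̃-cotree j _ (g̃-cotree k) (subst CotreeG̃ (sym (ιg̃≡g̃ k)) (g̃-cotree k)))

  wγ-γ̃ : ∀ k′ k → ⟨ wγ k′ , γ̃ k ⟩ ≡ δ k′ k
  wγ-γ̃ k′ k = trans (at-g̃ _ k′) (trans (γ̃-cotree k _ (g̃-cotree k′))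
    (trans (δ-injective g̃ g̃-injective k k′) (δ-sym k k′)))

  basisG̃-family dualG̃ : Fin (a ℕ.+ (a ℕ.+ (b ℕ.+ c))) → Chain G̃
  basisG̃-family = α̃⁺ ⊕ (α̃⁻ ⊕ (β̃ ⊕ γ̃))
  dualG̃ = w⁺ ⊕ (w⁻ ⊕ (wβ ⊕ wγ))

  dualityG̃ : ∀ j i → ⟨ dualG̃ j , basisG̃-family i ⟩ ≡ δ j i
  dualityG̃ = ⊕-dual α̃⁺ w⁺ (α̃⁻ ⊕ (β̃ ⊕ γ̃)) (w⁻ ⊕ (wβ ⊕ wγ)) w⁺-α̃⁺
    (λ j → ⊕-all (λ x → ⟨ w⁺ j , x ⟩ ≡ + 0) α̃⁻ (β̃ ⊕ γ̃) (w⁺-α̃⁻ j) (⊕-all (λ x → ⟨ w⁺ j , x ⟩ ≡ + 0) β̃ γ̃ (w⁺-β̃ j) (w⁺-γ̃ j)))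
    (λ j i → ⊕-all (λ w → ⟨ w , α̃⁺ i ⟩ ≡ + 0) w⁻ (wβ ⊕ wγ)
               (λ j′ → w⁻-α̃⁺ j′ i) (⊕-all (λ w → ⟨ w , α̃⁺ i ⟩ ≡ + 0) wβ wγ (λ j′ → wβ-α̃⁺ j′ i) (λ k → wγ-α̃⁺ k i)) j)
    (⊕-dual α̃⁻ w⁻ (β̃ ⊕ γ̃) (wβ ⊕ wγ) w⁻-α̃⁻
      (λ j → ⊕-all (λ x → ⟨ w⁻ j , x ⟩ ≡ + 0) β̃ γ̃ (w⁻-β̃ j) (w⁻-γ̃ j))
      (λ j i → ⊕-all (λ w → ⟨ w , α̃⁻ i ⟩ ≡ + 0) wβ wγ (λ j′ → wβ-α̃⁻ j′ i) (λ k → wγ-α̃⁻ k i) j)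
      (⊕-dual β̃ wβ γ̃ wγ wβ-β̃ wβ-γ̃ wγ-β̃ wγ-γ̃))

  dualG̃-detects : ∀ z → IsCycle G̃ z → (∀ j → ⟨ dualG̃ j , z ⟩ ≡ + 0) → ∀ e → z e ≡ + 0
  dualG̃-detects z z-cycle dual≡0 = TG̃.cycle-vanishing-off-tree z z-cycle off-tree
    where
    vanishes : Chain G̃ → Set
    vanishes w = ⟨ w , z ⟩ ≡ + 0
    rest₁ : ∀ j → vanishes ((w⁻ ⊕ (wβ ⊕ wγ)) j)
    rest₁ = ⊕-all-right vanishes w⁺ (w⁻ ⊕ (wβ ⊕ wγ)) dual≡0
    rest₂ : ∀ j → vanishes ((wβ ⊕ wγ) j)
    rest₂ = ⊕-all-right vanishes w⁻ (wβ ⊕ wγ) rest₁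
    z-ẽα : ∀ i → z (ẽα i) ≡ + 0
    z-ẽα i = trans (sym (at-ẽα z i)) (⊕-all-left vanishes w⁺ (w⁻ ⊕ (wβ ⊕ wγ)) dual≡0 i)
    z-ιẽα : ∀ i → z (ι (ẽα i)) ≡ + 0
    z-ιẽα i = trans (sym (at-ιẽα z i)) (⊕-all-left vanishes w⁻ (wβ ⊕ wγ) rest₁ i)
    z-g̃ : ∀ k → z (g̃ k) ≡ + 0
    z-g̃ k = trans (sym (at-g̃ z k)) (⊕-all-right vanishes wβ wγ rest₂ k)
    z-f̃⁻ : ∀ j → z (f̃⁻ j) ≡ + 0
    z-f̃⁻ j = trans (sym (ZP.+-identityʳ (z (f̃⁻ j))))
      (trans (cong (λ y → z (f̃⁻ j) - y) (sym (ΣZ-zero (λ i → trans (cong (correction j i *_) (z-ιẽα i)) (ZP.*-zeroʳ (correction j i))))))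
        (sgn-cancel (dir (t j)) _ (trans (sym (⟨wβ,⟩ j z)) (⊕-all-left vanishes wβ wγ rest₂ j))))
    off-tree : ∀ ẽ → CotreeG̃ ẽ → z ẽ ≡ + 0
    off-tree ẽ off with cover-cotree-edge ẽ off
    ... | inj₁ (i , refl)               = z-ẽα i
    ... | inj₂ (inj₁ (i , refl))        = z-ιẽα i
    ... | inj₂ (inj₂ (inj₁ (k , refl))) = z-g̃ k
    ... | inj₂ (inj₂ (inj₂ (j , refl))) = z-f̃⁻ j

  basisG̃ : IsBasis G̃ basisG̃-family
  basisG̃ = basis-from-dual G̃ basisG̃-family dualG̃
    (⊕-all (IsCycle G̃) α̃⁺ _ α̃⁺-cycle (⊕-all (IsCycle G̃) α̃⁻ _ α̃⁻-cycle (⊕-all (IsCycle G̃) β̃ γ̃ β̃-cycle γ̃-cycle)))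
    dualityG̃ dualG̃-detects

  tree-child : ∀ e → .(isTree e ≡ true) → Vtx G
  tree-child e _ with treeEdge? e
  ... | yes (w , _ , _) = w
  ... | no _            = r

  tree-child-par : ∀ e (on : isTree e ≡ true) → Σ (tree-child e on ≢ r) (λ w≢r → par (tree-child e on) w≢r ≡ e)
  tree-child-par e on with treeEdge? e
  ... | yes (w , w≢r , par-w) = w≢r , par-w

  isTree-par : ∀ v (v≢r : v ≢ r) → isTree (par v v≢r) ≡ true
  isTree-par v v≢r = dec-true (treeEdge? (par v v≢r)) (v , v≢r , refl)

  tree-dil tree-free : ℕ
  tree-dil  = count (λ e → dil e ∧ isTree e)
  tree-free = count (λ e → not (dil e) ∧ isTree e)

  edges-split : nE G ≡ m-dil π ℕ.+ count (not ∘ dil)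
  edges-split = trans (sym (count-all (nE G))) (count-split (λ _ → true) dil)

  free-edges-split : count (not ∘ dil) ≡ tree-free ℕ.+ a
  free-edges-split = count-split (not ∘ dil) isTree

  dil-edges-split : m-dil π ≡ tree-dil ℕ.+ c
  dil-edges-split = count-split dil isTree

  not-r⇒≢r : ∀ {v} → not [ v ≟' r ] ≡ true → v ≢ r
  not-r⇒≢r not-r v≡r = true≢false (trans (sym ([≟']-≡ v≡r)) (not-true not-r))

  -- Parent edges identify the non-root vertices with the tree edges.
  tree-edges : count isTree ≡ count (λ v → not [ v ≟' r ])
  tree-edges = sym (count-bij (λ v → not [ v ≟' r ]) isTree (λ v not-r → par v (not-r⇒≢r not-r)) tree-child
    (λ v not-r → isTree-par v (not-r⇒≢r not-r))
    (λ e on → cong not ([≟']-≢ (proj₁ (tree-child-par e on))))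
    (λ v not-r → TG.par-injective _ v (proj₁ (tree-child-par _ (isTree-par v (not-r⇒≢r not-r)))) (not-r⇒≢r not-r)
                   (proj₂ (tree-child-par _ (isTree-par v (not-r⇒≢r not-r)))))
    (λ e on → proj₂ (tree-child-par e on)))

  vertices : nV G ≡ 1 ℕ.+ (tree-dil ℕ.+ tree-free)
  vertices = begin
    nV G                                          ≡⟨ sym (count-all (nV G)) ⟩
    count {nV G} (λ _ → true)                     ≡⟨ count-split (λ _ → true) (λ v → [ v ≟' r ]) ⟩
    count (λ v → [ v ≟' r ]) ℕ.+ count (λ v → not [ v ≟' r ])  ≡⟨ cong₂ ℕ._+_ (count-singleton r) (sym tree-edges) ⟩
    1 ℕ.+ count isTree                            ≡⟨ cong (1 ℕ.+_) (count-split isTree dil) ⟩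
    1 ℕ.+ (count (λ e → isTree e ∧ dil e) ℕ.+ count (λ e → isTree e ∧ not (dil e)))
      ≡⟨ cong (1 ℕ.+_) (cong₂ ℕ._+_ (count-cong (λ e → BP.∧-comm (isTree e) (dil e)))
                                    (count-cong (λ e → BP.∧-comm (isTree e) (not (dil e))))) ⟩
    1 ℕ.+ (tree-dil ℕ.+ tree-free)                ∎
    where open ≡-Reasoning

  -- A dilated vertex is either a top or the child of a dilated tree edge.
  isBelowTop : Vtx G → Bool
  isBelowTop v = dilV v ∧ not (at-top v)

  dil-vertices-split : n-dil π ≡ count isTop ℕ.+ count isBelowTop
  dil-vertices-split = count-split dilV at-top

  below-top⇒≢r : ∀ {v} → isBelowTop v ≡ true → v ≢ r
  below-top⇒≢r below v≡r = true≢false (trans (sym at-top-r) (trans (cong at-top (sym v≡r)) (not-true (proj₂ (∧-true below)))))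

  below-top-par : ∀ v (below : isBelowTop v ≡ true) → DilE π (par v (below-top⇒≢r below))
  below-top-par v below = moving⇒dilated v (below-top⇒≢r below) (not-true (proj₂ (∧-true below)))

  dil-child-below-top : ∀ e (on : dil e ∧ isTree e ≡ true) → isBelowTop (tree-child e (proj₂ (∧-true on))) ≡ true
  dil-child-below-top e on = cong₂ _∧_ (dec-true (dilV? π w) w-dil) (cong not (dilated⇒moving w w≢r par-dil))
    where
    on-tree : isTree e ≡ true
    on-tree = proj₂ (∧-true on)
    w = tree-child e on-tree
    w≢r : w ≢ r
    w≢r = proj₁ (tree-child-par e on-tree)
    par-dil : DilE π (par w w≢r)
    par-dil = subst (DilE π) (sym (proj₂ (tree-child-par e on-tree))) (does-true (dilE? π e) (proj₁ (∧-true on)))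
    w-dil : DilV π w
    w-dil = subst (DilV π) (par-end w w≢r) (dilE-end (dir w) (par w w≢r) par-dil)

  below-tops : count isBelowTop ≡ tree-dil
  below-tops = count-bij isBelowTop (λ e → dil e ∧ isTree e)
    (λ v below → par v (below-top⇒≢r below))
    (λ e on → tree-child e (proj₂ (∧-true on)))
    (λ v below → cong₂ _∧_ (dec-true (dilE? π _) (below-top-par v below)) (isTree-par v (below-top⇒≢r below)))
    dil-child-below-top
    (λ v below → TG.par-injective _ v (proj₁ (tree-child-par _ (isTree-par v (below-top⇒≢r below)))) (below-top⇒≢r below)
                   (proj₂ (tree-child-par _ (isTree-par v (below-top⇒≢r below)))))
    (λ e on → proj₂ (tree-child-par e (proj₂ (∧-true on))))

  component-irrelevant : ∀ v (v-dil v-dil′ : DilV π v) → component (v , v-dil) ≡ component (v , v-dil′)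
  component-irrelevant v v-dil v-dil′ = walk⇒same-component (v , v-dil) (v , v-dil′) (here v-dil′)

  componentV : Vtx G → Fin d
  componentV v with dilV? π v
  ... | yes v-dil = component (v , v-dil)
  ... | no _      = component (r , r-dil)

  componentV-dil : ∀ v (v-dil : DilV π v) → componentV v ≡ component (v , v-dil)
  componentV-dil v v-dil with dilV? π v
  ... | yes v-dil′ = component-irrelevant v v-dil′ v-dil
  ... | no free    = ⊥-elim (free v-dil)

  top-same-component : ∀ (x : Σ (Vtx G) (DilV π)) (top-dil : DilV π (top (proj₁ x))) →
    component (top (proj₁ x) , top-dil) ≡ component x
  top-same-component (v , v-dil) top-dil = trans (component-irrelevant _ top-dil (proj₁ at-top-v)) (proj₂ at-top-v)
    where
    SameComponent : Vtx G → Set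
    SameComponent w = Σ (DilV π w) (λ w-dil → component (w , w-dil) ≡ component (v , v-dil))
    step : ∀ w (moving : at-top w ≡ false) → SameComponent w → SameComponent (parent w (ToTop.Target.moving⇒≢root moving))
    step w moving (w-dil , same) = parent-dil , trans (walk⇒same-component (_ , parent-dil) (w , w-dil) walk) same
      where
      w≢r : w ≢ r
      w≢r = ToTop.Target.moving⇒≢root moving
      par-dil : DilE π (par w w≢r)
      par-dil = moving⇒dilated w w≢r moving
      parent-dil : DilV π (parent w w≢r)
      parent-dil = dilE-end (not (dir w)) (par w w≢r) par-dil
      walk : DilWalk π (parent w w≢r) w
      walk = subst (DilWalk π (parent w w≢r)) (par-end w w≢r)
        (edge-walk (dir w) (par w w≢r) par-dil (subst (DilV π) (sym (par-end w w≢r)) w-dil))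
    at-top-v : SameComponent (top v)
    at-top-v = subst SameComponent (summit≡top v) (ToTop.Target.summit-invariant SameComponent step K v (v-dil , refl))

  top-stops : ∀ v → at-top (top v) ≡ true
  top-stops v = subst (λ u → at-top u ≡ true) (summit≡top v) (ToTop.Target.summit-stops K v (depth<K v))

  tops : count isTop ≡ d
  tops = trans (count-bij isTop (λ _ → true) (λ v _ → componentV v) (λ k _ → top (proj₁ (representative k)))
      (λ _ _ → refl)
      (λ k _ → cong₂ _∧_ (dec-true (dilV? π _) (top-dilated-vertex _ (proj₂ (representative k)))) (top-stops _))
      top-of-component component-of-top)
    (count-all d)
    where
    representative : Fin d → Σ (Vtx G) (DilV π)
    representative k = proj₁ (component-surjective k)
    top-of-component : ∀ v (v-top : isTop v ≡ true) → top (proj₁ (representative (componentV v))) ≡ v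
    top-of-component v v-top =
      trans (top-component (representative (componentV v)) (v , v-dil)
              (trans (proj₂ (component-surjective (componentV v))) (componentV-dil v v-dil)))
            (stops (v ≟ r))
      where
      v-dil : DilV π v
      v-dil = does-true (dilV? π v) (proj₁ (∧-true v-top))
      stops : Dec (v ≡ r) → top v ≡ v
      stops (yes refl) = top-root
      stops (no v≢r)   = top-free v v≢r (stopping⇒free v v≢r (proj₂ (∧-true v-top)))
    component-of-top : ∀ k (_ : true ≡ true) → componentV (top (proj₁ (representative k))) ≡ k
    component-of-top k _ = trans (componentV-dil _ top-dil)
      (trans (top-same-component (representative k) top-dil) (proj₂ (component-surjective k)))
      where
      top-dil : DilV π (top (proj₁ (representative k)))
      top-dil = top-dilated-vertex _ (proj₂ (representative k))

  tops-besides-r : count isTop ≡ 1 ℕ.+ b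
  tops-besides-r = trans (count-split isTop (λ v → [ v ≟' r ])) (cong (ℕ._+ b) (trans (count-cong only-r) (count-singleton r)))
    where
    r-top : isTop r ≡ true
    r-top = cong₂ _∧_ (dec-true (dilV? π r) r-dil) at-top-r
    only-r : ∀ v → isTop v ∧ [ v ≟' r ] ≡ [ v ≟' r ]
    only-r v = by-root (v ≟ r)
      where
      by-root : Dec (v ≡ r) → isTop v ∧ [ v ≟' r ] ≡ [ v ≟' r ]
      by-root (yes refl) rewrite [≟']-refl r = trans (BP.∧-identityʳ (isTop r)) r-top
      by-root (no v≢r)   rewrite [≟']-≢ v≢r = BP.∧-zeroʳ (isTop v)

  ℤ-+ : ∀ {m} n k → m ≡ n ℕ.+ k → + m ≡ + n + + k
  ℤ-+ n k eq = trans (cong +_ eq) (ZP.pos-+ n k)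

  a≡A : + a ≡ A π d
  a≡A = solve-A (+ a) (+ c) (+ tree-dil) (+ tree-free) (+ d) (+ nE G) (+ nV G) (+ m-dil π) (+ count (not ∘ dil)) (+ n-dil π)
    (ℤ-+ (m-dil π) _ edges-split) (ℤ-+ tree-free a free-edges-split) (ℤ-+ tree-dil c dil-edges-split)
    (trans (ℤ-+ 1 (tree-dil ℕ.+ tree-free) vertices) (cong (λ x → + 1 + x) (ZP.pos-+ tree-dil tree-free)))
    (ℤ-+ d tree-dil (trans dil-vertices-split (cong₂ ℕ._+_ tops below-tops)))
    where
    solve-A : ∀ a c Td Tf d E V md mf nd → E ≡ md + mf → mf ≡ Tf + a → md ≡ Td + c →
      V ≡ + 1 + (Td + Tf) → nd ≡ d + Td → a ≡ E - V + + 1 - md + nd - d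
    solve-A a c Td Tf d E V md mf nd refl refl refl refl refl = identity a c Td Tf d
      where
      identity : ∀ a c Td Tf d → a ≡ Td + c + (Tf + a) - (+ 1 + (Td + Tf)) + + 1 - (Td + c) + (d + Td) - d
      identity = solve-∀

  b≡B : + b ≡ B π d
  b≡B = solve-B (+ b) (+ d) (ℤ-+ 1 b (trans (sym tops) tops-besides-r))
    where
    solve-B : ∀ b d → d ≡ + 1 + b → b ≡ d - + 1
    solve-B b d refl = identity b
      where
      identity : ∀ b → b ≡ + 1 + b - + 1
      identity = solve-∀

  c≡C : + c ≡ C π d
  c≡C = solve-C (+ c) (+ tree-dil) (+ d) (+ m-dil π) (+ n-dil π) (ℤ-+ tree-dil c dil-edges-split)
    (ℤ-+ d tree-dil (trans dil-vertices-split (cong₂ ℕ._+_ tops below-tops)))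
    where
    solve-C : ∀ c Td d md nd → md ≡ Td + c → nd ≡ d + Td → c ≡ md - nd + d
    solve-C c Td d md nd refl refl = identity c Td d
      where
      identity : ∀ c Td d → c ≡ Td + c - (d + Td) + d
      identity = solve-∀

  adapted-bases : AdaptedBases π ι d
  adapted-bases = record
    { a = a ; b = b ; c = c
    ; a≡A = a≡A ; b≡B = b≡B ; c≡C = c≡C
    ; α = α ; γ = γ ; α̃⁺ = α̃⁺ ; α̃⁻ = α̃⁻ ; β̃ = β̃ ; γ̃ = γ̃
    ; basis = basisG ; basis~ = basisG̃
    ; ια⁺ = ια⁺ ; ια⁻ = ια⁻ ; πα⁺ = πα⁺ ; πα⁻ = πα⁻ ; π^α = π^α
    ; ιβ = ιβ ; πβ = πβ ; ιγ = ιγ ; πγ = πγ ; π^γ = π^γ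
    }

proposition4p20 : (G̃ G : Graph) → Connected G →
    (π : DoubleCover G̃ G) → IsDilated π →
    (ι : Fin (nE G̃) → Fin (nE G̃)) → IsSheetInvolution π ι →
    (d : ℕ) → NumComponents π d →
    AdaptedBases π ι d
proposition4p20 G̃ G connected π dilated ι ι-sheet d nc =
  Construction.adapted-bases π ι ι-sheet nc r r-dil (adapted-tree π connected nc r)
  where
  dilated-vertex : IsDilated π → Σ (Vtx G) (DilV π)
  dilated-vertex (inj₁ (v , v-dil)) = v , v-dil
  dilated-vertex (inj₂ (e , e-dil)) = src G e , CoverFibres.dilE-end π false e e-dil
  r : Vtx G
  r = proj₁ (dilated-vertex dilated)
  r-dil : DilV π r
  r-dil = proj₂ (dilated-vertex dilated)
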